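{- Let $A, B \subseteq \omega$ with $B$ infinite, and suppose that $A \le^{i}_{T} B$, i.e. every infinite subset of $B$ computes $A$. Then there is an infinite set $C \subseteq B$ such that $A \le^{ui}_{T} C$, i.e. there is a single Turing functional $\Phi$ with $\Phi(S) = A$ for every infinite $S \subseteq C$.
   Context: For sets $A,B\subseteq\omega$ with $B$ infinite: $A \le^{i}_{T} B$ ("$A$ is introcomputable from $B$") means every infinite subset of $B$ computes $A$; $A \le^{ui}_{T} B$ ("$A$ is uniformly introcomputable from $B$") means there is a fixed Turing functional $\Phi$ such that $\Phi(S)=A$ for every infinite $S\subseteq B$. -}

module Defs where

open import Data.Nat using (ℕ; zero; suc; _≤_; _≟_)
open import Data.Bool using (Bool; true; false; if_then_else_)
open import Data.List using (List; []; _∷_)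
open import Data.Maybe using (Maybe; just; nothing)
open import Data.Product using (Σ; ∃; ∃-syntax; _×_; _,_)
open import Relation.Nullary using (yes; no)
open import Relation.Binary.PropositionalEquality using (_≡_)

SetN : Set
SetN = ℕ → Bool

_⊆_ : SetN → SetN → Set
S ⊆ B = ∀ n → S n ≡ true → B n ≡ true

Infinite : SetN → Set
Infinite B = ∀ n → ∃[ m ] (n ≤ m × B m ≡ true)

-- Oracle register machines (a standard model of Turing functionals).
-- Registers indexed by ℕ; pc indexes into the program; the machine
-- halts when pc points outside the program.

data Instr : Set where
  inc : (r : ℕ) → Instr
  dec : (r : ℕ) → (j : ℕ) → Instr
  orc : (r : ℕ) → Instr

Program : Set
Program = List Instr

record State : Set where
  constructor ⟨_,_⟩
  field
    pc   : ℕ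
    regs : ℕ → ℕ
open State public

fetch : Program → ℕ → Maybe Instr
fetch []      _       = nothing
fetch (i ∷ _) zero    = just i
fetch (_ ∷ P) (suc k) = fetch P k

update : (ℕ → ℕ) → ℕ → ℕ → (ℕ → ℕ)
update R r v k with k ≟ r
... | yes _ = v
... | no  _ = R k

exec : SetN → Instr → State → State
exec X (inc r)   ⟨ p , R ⟩ = ⟨ suc p , update R r (suc (R r)) ⟩
exec X (dec r j) ⟨ p , R ⟩ with R r
... | zero  = ⟨ j , R ⟩
... | suc v = ⟨ suc p , update R r v ⟩
exec X (orc r)   ⟨ p , R ⟩ = ⟨ suc p , update R r (if X (R r) then 1 else 0) ⟩

run : Program → SetN → ℕ → State → Maybe State
run P X fuel st with fetch P (pc st)
... | nothing = just st
run P X zero    st | just i = nothing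
run P X (suc f) st | just i = run P X f (exec X i st)

initial : ℕ → State
initial n = ⟨ 0 , (λ { zero → n ; (suc _) → 0 }) ⟩

output : State → Bool
output st with regs st 0
... | zero  = false
... | suc _ = true

_⟨_⟩_↓_ : Program → SetN → ℕ → Bool → Set
Φ ⟨ X ⟩ n ↓ b = ∃[ s ] Σ State (λ st → run Φ X s (initial n) ≡ just st × output st ≡ b)

Computes : Program → SetN → SetN → Set
Computes Φ X A = ∀ n → Φ ⟨ X ⟩ n ↓ A n

_≤T_ : SetN → SetN → Set
A ≤T X = ∃[ Φ ] Computes Φ X A

_≤iT_ : SetN → SetN → Set
A ≤iT B = ∀ S → Infinite S → S ⊆ B → A ≤T S

_≤uiT_ : SetN → SetN → Set
A ≤uiT B = ∃[ Φ ] (∀ S → Infinite S → S ⊆ B → Computes Φ S A)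

module Submission where

-- Mathias forcing with conditions (F, b, C): F ⊆ B finite and below b,
-- C ⊆ B ∩ [b, ∞) infinite.  For a program P, a condition can be strengthened so that it
-- forces P(G) ≠ A, either by a finite σ ⊆ C and an n with P^(F ∪ σ)(n) converging to the
-- wrong value, or by an n and an infinite C' ⊆ C such that P^(F ∪ σ)(n) diverges for all
-- finite σ ⊆ C'.  If this succeeded for every P, the generic G ⊆ B would be infinite and
-- compute A by no program, contradicting A ≤ⁱ B.  So at some condition neither alternative
-- is available for some P, and then a single functional works on every infinite S ⊆ C:
-- search for a finite σ ⊆ S making P^(F ∪ σ)(n) converge, and output its value, which
-- must be A(n).  To make the search uniform in S, a number j codes a finite set by its
-- binary digits, intersected with S by oracle queries; the functional Ψ is a register
-- program that runs P for j steps answering a query q by F q ∨ (bit q of j ∧ S q), and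
-- moves on to j + 1 when time runs out.

open import Defs
open import Level using (0ℓ)
open import Axiom.ExcludedMiddle using (ExcludedMiddle)
open import Data.Nat
open import Data.Nat.Properties
open import Data.Bool using (Bool; true; false; if_then_else_; _∧_; _∨_; T)
import Data.Bool
open import Data.Bool.Properties using (∧-zeroʳ; ∧-identityʳ; ∨-zeroʳ; ∨-identityʳ)
open import Data.Unit using (tt)
open import Data.List using (List; []; _∷_; _++_; length; map)
open import Data.List.Properties using (length-map; length-++)
open import Data.Maybe using (Maybe; just; nothing)
open import Data.Maybe.Properties using (just-injective)
open import Data.Product using (Σ; ∃; ∃-syntax; _×_; _,_; proj₁; proj₂)
open import Data.Sum using (_⊎_; inj₁; inj₂)
open import Data.Empty using (⊥; ⊥-elim)
open import Relation.Nullary using (yes; no; ¬_; Dec)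
open import Relation.Binary.PropositionalEquality
open import Data.Nat.Tactic.RingSolver using (solve-∀)

-- Register machines

update-same : ∀ R r v → update R r v r ≡ v
update-same R r v with r ≟ r
... | yes _ = refl
... | no ne = ⊥-elim (ne refl)

update-other : ∀ R r v k → k ≢ r → update R r v k ≡ R k
update-other R r v k ne with k ≟ r
... | yes e = ⊥-elim (ne e)
... | no _ = refl

exec-dec-zero : ∀ X r j p R → R r ≡ 0 → exec X (dec r j) ⟨ p , R ⟩ ≡ ⟨ j , R ⟩
exec-dec-zero X r j p R e with R r
exec-dec-zero X r j p R refl | .zero = refl

exec-dec-suc : ∀ X r j p R v → R r ≡ suc v → exec X (dec r j) ⟨ p , R ⟩ ≡ ⟨ suc p , update R r v ⟩
exec-dec-suc X r j p R v e with R r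
exec-dec-suc X r j p R v refl | .(suc v) = refl

exec-oracle-cong : ∀ X Y i st → (∀ r → i ≡ orc r → X (regs st r) ≡ Y (regs st r)) → exec X i st ≡ exec Y i st
exec-oracle-cong X Y (inc r) ⟨ p , R ⟩ h = refl
exec-oracle-cong X Y (dec r j) ⟨ p , R ⟩ h with R r
... | zero = refl
... | suc v = refl
exec-oracle-cong X Y (orc r) ⟨ p , R ⟩ h rewrite h r refl = refl

run-more-fuel : ∀ P X s st st' → run P X s st ≡ just st' → ∀ k → run P X (s + k) st ≡ just st'
run-more-fuel P X s st st' e k with fetch P (pc st)
run-more-fuel P X s st st' e k | nothing = e
run-more-fuel P X zero st st' () k | just i
run-more-fuel P X (suc s) st st' e k | just i = run-more-fuel P X s (exec X i st) st' e k

run-deterministic : ∀ P X s s' st a b → run P X s st ≡ just a → run P X s' st ≡ just b → a ≡ b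
run-deterministic P X s s' st a b e e' = just-injective (begin
  just a              ≡⟨ run-more-fuel P X s st a e s' ⟨
  run P X (s + s') st ≡⟨ cong (λ z → run P X z st) (+-comm s s') ⟩
  run P X (s' + s) st ≡⟨ run-more-fuel P X s' st b e' s ⟩
  just b              ∎)
  where open ≡-Reasoning

run-halted : ∀ P X s st → fetch P (pc st) ≡ nothing → run P X s st ≡ just st
run-halted P X s st e with fetch P (pc st) | e
... | nothing | refl = refl

run-step : ∀ P X s st i → fetch P (pc st) ≡ just i → run P X (suc s) st ≡ run P X s (exec X i st)
run-step P X s st i e with fetch P (pc st) | e
... | just _ | refl = refl

AgreeBelow : SetN → SetN → ℕ → Set
AgreeBelow X Y u = ∀ k → k < u → X k ≡ Y k

queriedRegister : Instr → ℕ
queriedRegister (inc r) = 0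
queriedRegister (dec r j) = 0
queriedRegister (orc r) = r

use-principle : ∀ P X s st st' → run P X s st ≡ just st' →
                ∃[ u ] (∀ Y → AgreeBelow X Y u → run P Y s st ≡ just st')
use-principle P X s st st' e with fetch P (pc st) in eq
use-principle P X s st st' e | nothing = 0 , λ Y _ → e
use-principle P X zero st st' () | just i
use-principle P X (suc s) st st' e | just i with use-principle P X s (exec X i st) st' e
... | u , h = suc (regs st (queriedRegister i)) ⊔ u , λ Y ag →
    trans (cong (run P Y s) (sym (exec-oracle-cong X Y i st (query-agrees Y ag))))
          (h Y (λ k k<u → ag k (<-≤-trans k<u (m≤n⊔m _ u))))
    where
    query-agrees : ∀ Y → AgreeBelow X Y (suc (regs st (queriedRegister i)) ⊔ u) →
                   ∀ r → i ≡ orc r → X (regs st r) ≡ Y (regs st r)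
    query-agrees Y ag r refl = ag _ (<-≤-trans (n<1+n _) (m≤m⊔n _ u))

data Reach (P : Program) (X : SetN) : State → State → Set where
  done : ∀ {st} → Reach P X st st
  step : ∀ {st st' i} → fetch P (pc st) ≡ just i → Reach P X (exec X i st) st' → Reach P X st st'

reach-trans : ∀ {P X a b c} → Reach P X a b → Reach P X b c → Reach P X a c
reach-trans done r = r
reach-trans (step f r) r' = step f (reach-trans r r')

reach-dec-zero : ∀ {P X a r j R st'} → fetch P a ≡ just (dec r j) → R r ≡ 0 →
                 Reach P X ⟨ j , R ⟩ st' → Reach P X ⟨ a , R ⟩ st'
reach-dec-zero {P} {X} {a} {r} {j} {R} f e g = step f (subst (λ s → Reach P X s _) (sym (exec-dec-zero X r j a R e)) g)

reach-dec-suc : ∀ {P X a r j R v st'} → fetch P a ≡ just (dec r j) → R r ≡ suc v →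
                Reach P X ⟨ suc a , update R r v ⟩ st' → Reach P X ⟨ a , R ⟩ st'
reach-dec-suc {P} {X} {a} {r} {j} {R} {v} f e g = step f (subst (λ s → Reach P X s _) (sym (exec-dec-suc X r j a R v e)) g)

reach⇒run : ∀ {P X st st'} → Reach P X st st' → fetch P (pc st') ≡ nothing → ∃[ f ] run P X f st ≡ just st'
reach⇒run {P} {X} {st} done e = 0 , run-halted P X 0 st e
reach⇒run {P} {X} {st} {st'} (step {i = i} f r) e with reach⇒run r e
... | k , h = suc k , trans (run-step P X k st i f) h

output-cong : ∀ a b → regs a 0 ≡ regs b 0 → output a ≡ output b
output-cong ⟨ p , R ⟩ ⟨ p' , R' ⟩ e with R 0 | R' 0
output-cong ⟨ p , R ⟩ ⟨ p' , R' ⟩ refl | zero | .zero = refl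
output-cong ⟨ p , R ⟩ ⟨ p' , R' ⟩ refl | suc x | .(suc x) = refl

record Code (Ψ : Program) (a : ℕ) (xs : List Instr) : Set where
  constructor mkCode
  field getCode : ∀ k i → fetch xs k ≡ just i → fetch Ψ (k + a) ≡ just i
open Code public

code-head : ∀ {Ψ a x xs} → Code Ψ a (x ∷ xs) → fetch Ψ a ≡ just x
code-head c = getCode c 0 _ refl

code-tail : ∀ {Ψ a x xs} → Code Ψ a (x ∷ xs) → Code Ψ (suc a) xs
code-tail {Ψ} {a} c = mkCode λ k i e → subst (λ z → fetch Ψ z ≡ just i) (sym (+-suc k a)) (getCode c (suc k) i e)

fetch-++ʳ : ∀ (xs ys : List Instr) k → fetch (xs ++ ys) (length xs + k) ≡ fetch ys k
fetch-++ʳ [] ys k = refl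
fetch-++ʳ (x ∷ xs) ys k = fetch-++ʳ xs ys k

fetch-++ˡ : ∀ (xs ys : List Instr) k i → fetch xs k ≡ just i → fetch (xs ++ ys) k ≡ just i
fetch-++ˡ [] ys k i ()
fetch-++ˡ (x ∷ xs) ys zero i e = e
fetch-++ˡ (x ∷ xs) ys (suc k) i e = fetch-++ˡ xs ys k i e

code-++ˡ : ∀ {Ψ a} xs ys → Code Ψ a (xs ++ ys) → Code Ψ a xs
code-++ˡ xs ys c = mkCode λ k i e → getCode c k i (fetch-++ˡ xs ys k i e)

code-++ʳ : ∀ {Ψ a} xs ys → Code Ψ a (xs ++ ys) → Code Ψ (length xs + a) ys
code-++ʳ {Ψ} {a} xs ys c = mkCode λ k i e →
  subst (λ z → fetch Ψ z ≡ just i) (trans (cong (_+ a) (+-comm (length xs) k)) (+-assoc k (length xs) a))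
    (getCode c (length xs + k) i (trans (fetch-++ʳ xs ys k) e))

code-self : ∀ Ψ → Code Ψ 0 Ψ
code-self Ψ = mkCode λ k i e → subst (λ z → fetch Ψ z ≡ just i) (sym (+-identityʳ k)) e

fetch-past-end : ∀ (Ψ : Program) k → length Ψ ≤ k → fetch Ψ k ≡ nothing
fetch-past-end [] k _ = refl
fetch-past-end (x ∷ Ψ) (suc k) (s≤s le) = fetch-past-end Ψ k le

-- Macros

count : List ℕ → ℕ → ℕ
count [] k = 0
count (d ∷ ds) k = (if k ≡ᵇ d then 1 else 0) + count ds k

≡ᵇ-refl : ∀ d → (d ≡ᵇ d) ≡ true
≡ᵇ-refl zero = refl
≡ᵇ-refl (suc d) = ≡ᵇ-refl d

≢⇒≡ᵇ-false : ∀ k d → k ≢ d → (k ≡ᵇ d) ≡ false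
≢⇒≡ᵇ-false zero zero ne = ⊥-elim (ne refl)
≢⇒≡ᵇ-false zero (suc d) ne = refl
≢⇒≡ᵇ-false (suc k) zero ne = refl
≢⇒≡ᵇ-false (suc k) (suc d) ne = ≢⇒≡ᵇ-false k d (λ e → ne (cong suc e))

count-hit : ∀ d → count (d ∷ []) d ≡ 1
count-hit d rewrite ≡ᵇ-refl d = refl

count-miss : ∀ d k → k ≢ d → count (d ∷ []) k ≡ 0
count-miss d k ne rewrite ≢⇒≡ᵇ-false k d ne = refl

count-miss₂ : ∀ d d' k → k ≢ d → k ≢ d' → count (d ∷ d' ∷ []) k ≡ 0
count-miss₂ d d' k ne ne' rewrite ≢⇒≡ᵇ-false k d ne | ≢⇒≡ᵇ-false k d' ne' = refl

-- Conventions of the macros below: a macro placed at address a is told a, so that loops can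
-- jump back to their start; register 7 is kept at 0, which makes `dec 7 t` an unconditional
-- jump to t; registers 4, 5 and 6 are scratch.

drainCode : ℕ → ℕ → List ℕ → ℕ → List Instr
drainCode a src ds ex = dec src ex ∷ (map inc ds ++ (dec 7 a ∷ []))

copyCode : ℕ → ℕ → ℕ → ℕ → List Instr
copyCode a src d t = drainCode a src (d ∷ t ∷ []) (4 + a) ++ drainCode (4 + a) t (src ∷ []) (7 + a)

-- Jumps to tgt (k + t) when register 4 holds t < c, and falls through otherwise.
dispatchCode : (ℕ → ℕ) → ℕ → ℕ → List Instr
dispatchCode tgt k zero = []
dispatchCode tgt k (suc c) = dec 4 (tgt k) ∷ dispatchCode tgt (suc k) c

halveCode : ℕ → List Instr
halveCode a = dec 4 (4 + a) ∷ dec 4 (4 + a) ∷ inc 5 ∷ dec 7 a ∷ drainCode (4 + a) 5 (4 ∷ []) (7 + a)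

-- shiftR c t = ⌊ t / 2 ^ c ⌋, so odd (shiftR c t) is the c-th binary digit of t.
shiftR : ℕ → ℕ → ℕ
shiftR zero t = t
shiftR (suc c) t = shiftR c ⌊ t /2⌋

shiftCode : ℕ → List Instr
shiftCode H = dec 6 (9 + H) ∷ (halveCode (1 + H) ++ (dec 7 H ∷ []))

odd : ℕ → Bool
odd zero = false
odd (suc zero) = true
odd (suc (suc n)) = odd n

oddCode : ℕ → ℕ → ℕ → List Instr
oddCode P EV OD = dec 4 EV ∷ dec 4 OD ∷ dec 7 P ∷ []

length-dispatchCode : ∀ tgt k c → length (dispatchCode tgt k c) ≡ c
length-dispatchCode tgt k zero = refl
length-dispatchCode tgt k (suc c) = cong suc (length-dispatchCode tgt (suc k) c)

module Macros (Ψ : Program) (X : SetN) where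

  Reaches : State → ℕ → ((ℕ → ℕ) → Set) → Set
  Reaches st a P = ∃[ st' ] (Reach Ψ X st st' × pc st' ≡ a × P (regs st'))

  reaches-seq : ∀ {st a a2 P Q} → Reaches st a P → (∀ st1 → pc st1 ≡ a → P (regs st1) → Reaches st1 a2 Q) → Reaches st a2 Q
  reaches-seq (st1 , r1 , e1 , p1) k with k st1 e1 p1
  ... | st2 , r2 , e2 , p2 = st2 , reach-trans r1 r2 , e2 , p2

  reaches-step : ∀ {st a P i} → fetch Ψ (pc st) ≡ just i → Reaches (exec X i st) a P → Reaches st a P
  reaches-step f (st1 , r1 , e1 , p1) = st1 , step f r1 , e1 , p1

  reaches-here : ∀ {st a P} → pc st ≡ a → P (regs st) → Reaches st a P
  reaches-here {st} e p = st , done , e , p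

  reaches-mono : ∀ {st a P Q} → Reaches st a P → (∀ R → P R → Q R) → Reaches st a Q
  reaches-mono (st1 , r1 , e1 , p1) f = st1 , r1 , e1 , f _ p1

  reaches-dec-zero : ∀ {a r j R t P} → fetch Ψ a ≡ just (dec r j) → R r ≡ 0 →
                     Reaches ⟨ j , R ⟩ t P → Reaches ⟨ a , R ⟩ t P
  reaches-dec-zero f e (st1 , r1 , e1 , p1) = st1 , reach-dec-zero f e r1 , e1 , p1

  reaches-dec-suc : ∀ {a r j R v t P} → fetch Ψ a ≡ just (dec r j) → R r ≡ suc v →
                    Reaches ⟨ suc a , update R r v ⟩ t P → Reaches ⟨ a , R ⟩ t P
  reaches-dec-suc f e (st1 , r1 , e1 , p1) = st1 , reach-dec-suc f e r1 , e1 , p1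

  jump-spec : ∀ a t st → fetch Ψ a ≡ just (dec 7 t) → pc st ≡ a → regs st 7 ≡ 0 →
              Reaches st t (λ R → ∀ k → R k ≡ regs st k)
  jump-spec a t ⟨ .a , R ⟩ f refl z = reaches-dec-zero f z (reaches-here refl (λ k → refl))

  inc-spec : ∀ a r st → fetch Ψ a ≡ just (inc r) → pc st ≡ a →
             Reaches st (suc a) (λ R → R r ≡ suc (regs st r) × ∀ k → k ≢ r → R k ≡ regs st k)
  inc-spec a r ⟨ .a , R ⟩ f refl = reaches-step f (reaches-here refl (update-same R r _ , λ k ne → update-other R r _ k ne))

  incs-spec : ∀ ds a st → Code Ψ a (map inc ds) → pc st ≡ a →
              Reaches st (length ds + a) (λ R → ∀ k → R k ≡ regs st k + count ds k)
  incs-spec [] a st c e = reaches-here e (λ k → sym (+-identityʳ _))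
  incs-spec (d ∷ ds) a ⟨ .a , R ⟩ c refl =
    reaches-step (code-head c)
      (subst (λ z → Reaches ⟨ suc a , update R d (suc (R d)) ⟩ z (λ R' → ∀ k → R' k ≡ R k + count (d ∷ ds) k))
        (+-suc (length ds) a)
        (reaches-mono (incs-spec ds (suc a) _ (code-tail c) refl) λ R' h k → trans (h k) (first-inc k (k ≟ d))))
    where
    first-inc : ∀ k → Dec (k ≡ d) → update R d (suc (R d)) k + count ds k ≡ R k + count (d ∷ ds) k
    first-inc k (yes refl) rewrite update-same R k (suc (R k)) | ≡ᵇ-refl k = sym (+-suc (R k) (count ds k))
    first-inc k (no ne) rewrite update-other R d (suc (R d)) k ne | ≢⇒≡ᵇ-false k d ne = refl

  drain-spec : ∀ a src ds ex → Code Ψ a (drainCode a src ds ex) → count ds src ≡ 0 → count ds 7 ≡ 0 → src ≢ 7 →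
               ∀ st → pc st ≡ a → regs st 7 ≡ 0 →
               Reaches st ex (λ R' → R' src ≡ 0 × ∀ k → k ≢ src → R' k ≡ regs st k + regs st src * count ds k)
  drain-spec a src ds ex c src∉ds 7∉ds src≢7 st e z = drain (regs st src) st refl e z
    where
    Drained : (ℕ → ℕ) → (ℕ → ℕ) → Set
    Drained R R' = R' src ≡ 0 × ∀ k → k ≢ src → R' k ≡ R k + R src * count ds k
    cIncs : Code Ψ (suc a) (map inc ds)
    cIncs = code-++ˡ (map inc ds) (dec 7 a ∷ []) (code-tail c)
    cJump : fetch Ψ (length ds + suc a) ≡ just (dec 7 a)
    cJump = subst (λ z → fetch Ψ (z + suc a) ≡ just (dec 7 a)) (length-map inc ds)
                  (code-head (code-++ʳ (map inc ds) (dec 7 a ∷ []) (code-tail c)))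
    drain : ∀ v st → regs st src ≡ v → pc st ≡ a → regs st 7 ≡ 0 → Reaches st ex (Drained (regs st))
    drain zero ⟨ .a , R ⟩ v refl z =
      reaches-dec-zero (code-head c) v
        (reaches-here refl (v , λ k _ → sym (trans (cong (λ w → R k + w * count ds k) v) (+-identityʳ _))))
    drain (suc v) ⟨ .a , R ⟩ ev refl z =
      reaches-dec-suc (code-head c) ev (reaches-seq (incs-spec ds (suc a) _ cIncs refl) after-incs)
      where
      R1 : ℕ → ℕ
      R1 = update R src v
      AfterIncs : (ℕ → ℕ) → Set
      AfterIncs R' = ∀ k → R' k ≡ R1 k + count ds k
      7-still-zero : ∀ {R'} → AfterIncs R' → R' 7 ≡ 0
      7-still-zero h1 = trans (h1 7) (trans (cong (_+ count ds 7) (update-other R src v 7 (λ x → src≢7 (sym x))))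
                                     (trans (cong (R 7 +_) 7∉ds) (trans (+-identityʳ _) z)))
      after-jump : ∀ st1 → AfterIncs (regs st1) → ∀ st2 → pc st2 ≡ a → (∀ k → regs st2 k ≡ regs st1 k) →
                   Reaches st2 ex (Drained R)
      after-jump st1 h1 st2 e2 h2 = reaches-mono (drain v st2 src≡v e2 (trans (h2 7) (7-still-zero h1)))
            λ R' (h3 , h4) → h3 , λ k nk → trans (h4 k nk) (added k nk)
        where
        src≡v : regs st2 src ≡ v
        src≡v = trans (h2 src) (trans (h1 src) (trans (cong₂ _+_ (update-same R src v) src∉ds) (+-identityʳ v)))
        added : ∀ k → k ≢ src → regs st2 k + regs st2 src * count ds k ≡ R k + R src * count ds k
        added k nk = begin
          regs st2 k + regs st2 src * count ds k  ≡⟨ cong₂ (λ x w → x + w * count ds k) (h2 k) src≡v ⟩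
          regs st1 k + v * count ds k             ≡⟨ cong (_+ v * count ds k) (h1 k) ⟩
          R1 k + count ds k + v * count ds k      ≡⟨ cong (λ x → x + count ds k + v * count ds k) (update-other R src v k nk) ⟩
          R k + count ds k + v * count ds k       ≡⟨ +-assoc (R k) (count ds k) (v * count ds k) ⟩
          R k + suc v * count ds k                ≡⟨ cong (λ w → R k + w * count ds k) ev ⟨
          R k + R src * count ds k                ∎
          where open ≡-Reasoning
      after-incs : ∀ st1 → pc st1 ≡ length ds + suc a → AfterIncs (regs st1) → Reaches st1 ex (Drained R)
      after-incs st1 e1 h1 = reaches-seq (jump-spec (length ds + suc a) a st1 cJump e1 (7-still-zero h1)) (after-jump st1 h1)

  private
    +-*0 : ∀ x y c → c ≡ 0 → x + y * c ≡ x
    +-*0 x y _ refl = trans (cong (x +_) (*-zeroʳ y)) (+-identityʳ x)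

    +-*1 : ∀ x y c → c ≡ 1 → x + y * c ≡ x + y
    +-*1 x y _ refl = cong (x +_) (*-identityʳ y)

  clear-spec : ∀ a src ex → Code Ψ a (drainCode a src [] ex) → src ≢ 7 → ∀ st → pc st ≡ a → regs st 7 ≡ 0 →
               Reaches st ex (λ R' → R' src ≡ 0 × ∀ k → k ≢ src → R' k ≡ regs st k)
  clear-spec a src ex c ne st e z = reaches-mono (drain-spec a src [] ex c refl refl ne st e z)
    λ R' (h1 , h2) → h1 , λ k nk → trans (h2 k nk) (+-*0 (regs st k) (regs st src) _ refl)

  move-spec : ∀ a src d ex → Code Ψ a (drainCode a src (d ∷ []) ex) → src ≢ 7 → src ≢ d → 7 ≢ d →
              ∀ st → pc st ≡ a → regs st 7 ≡ 0 →
              Reaches st ex (λ R' → R' src ≡ 0 × R' d ≡ regs st d + regs st src ×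
                                    ∀ k → k ≢ src → k ≢ d → R' k ≡ regs st k)
  move-spec a src d ex c ne1 ne2 ne3 st e z =
    reaches-mono (drain-spec a src (d ∷ []) ex c (count-miss d src ne2) (count-miss d 7 ne3) ne1 st e z)
    λ R' (h1 , h2) → h1 , trans (h2 d (λ x → ne2 (sym x))) (+-*1 (regs st d) (regs st src) _ (count-hit d))
                   , λ k nk nd → trans (h2 k nk) (+-*0 (regs st k) (regs st src) _ (count-miss d k nd))

  move₂-spec : ∀ a src d d' ex → Code Ψ a (drainCode a src (d ∷ d' ∷ []) ex) →
               src ≢ 7 → src ≢ d → src ≢ d' → 7 ≢ d → 7 ≢ d' → d ≢ d' →
               ∀ st → pc st ≡ a → regs st 7 ≡ 0 →
               Reaches st ex (λ R' → R' src ≡ 0 × R' d ≡ regs st d + regs st src × R' d' ≡ regs st d' + regs st src ×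
                                     ∀ k → k ≢ src → k ≢ d → k ≢ d' → R' k ≡ regs st k)
  move₂-spec a src d d' ex c ne1 ne2 ne3 ne4 ne5 ne6 st e z =
    reaches-mono (drain-spec a src (d ∷ d' ∷ []) ex c (count-miss₂ d d' src ne2 ne3) (count-miss₂ d d' 7 ne4 ne5) ne1 st e z)
    λ R' (h1 , h2) → h1 , trans (h2 d (λ x → ne2 (sym x))) (+-*1 (regs st d) (regs st src) _ hit-d)
                   , trans (h2 d' (λ x → ne3 (sym x))) (+-*1 (regs st d') (regs st src) _ hit-d')
                   , λ k nk nd nd' → trans (h2 k nk) (+-*0 (regs st k) (regs st src) _ (count-miss₂ d d' k nd nd'))
    where
    hit-d : count (d ∷ d' ∷ []) d ≡ 1
    hit-d rewrite ≡ᵇ-refl d | ≢⇒≡ᵇ-false d d' ne6 = refl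
    hit-d' : count (d ∷ d' ∷ []) d' ≡ 1
    hit-d' rewrite ≢⇒≡ᵇ-false d' d (λ x → ne6 (sym x)) | ≡ᵇ-refl d' = refl

  copy-spec : ∀ a src d t → Code Ψ a (copyCode a src d t) → src ≢ 7 → src ≢ d → src ≢ t → 7 ≢ d → 7 ≢ t → d ≢ t →
          ∀ st → pc st ≡ a → regs st 7 ≡ 0 → regs st t ≡ 0 →
          Reaches st (7 + a) (λ R' → R' src ≡ regs st src × R' d ≡ regs st d + regs st src × R' t ≡ 0 ×
                                  ∀ k → k ≢ src → k ≢ d → k ≢ t → R' k ≡ regs st k)
  copy-spec a src d t c n1 n2 n3 n4 n5 n6 st e z zt =
    reaches-seq (move₂-spec a src d t (4 + a) (code-++ˡ (drainCode a src (d ∷ t ∷ []) (4 + a)) _ c) n1 n2 n3 n4 n5 n6 st e z)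
    λ st1 e1 (h1 , h2 , h3 , h4) →
      reaches-mono (move-spec (4 + a) t src (7 + a) (code-++ʳ (drainCode a src (d ∷ t ∷ []) (4 + a)) (drainCode (4 + a) t (src ∷ []) (7 + a)) c)
                  (λ x → n5 (sym x)) (λ x → n3 (sym x)) (λ x → n1 (sym x)) st1 e1 (trans (h4 7 (λ x → n1 (sym x)) n4 n5) z))
      λ R' (g1 , g2 , g3) →
        trans g2 (cong₂ _+_ h1 (trans h3 (cong (_+ regs st src) zt)))
        , trans (g3 d (λ x → n6 x) (λ x → n2 (sym x))) h2
        , g1
        , λ k nk nd nt → trans (g3 k nt nk) (h4 k nk nd nt)

  dispatch-hit : ∀ tgt c k a st t → Code Ψ a (dispatchCode tgt k c) → pc st ≡ a → regs st 4 ≡ t → t < c →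
                 Reaches st (tgt (t + k)) (λ R' → R' 4 ≡ 0 × ∀ k' → k' ≢ 4 → R' k' ≡ regs st k')
  dispatch-hit tgt (suc c) k a ⟨ .a , R ⟩ zero cd refl e lt =
    reaches-dec-zero (code-head cd) e (reaches-here refl (e , λ k' _ → refl))
  dispatch-hit tgt (suc c) k a ⟨ .a , R ⟩ (suc t) cd refl e (s≤s lt) =
    reaches-dec-suc (code-head cd) e
      (subst (λ z → Reaches ⟨ suc a , update R 4 t ⟩ (tgt z) (λ R' → R' 4 ≡ 0 × ∀ k' → k' ≢ 4 → R' k' ≡ R k')) (+-suc t k)
        (reaches-mono (dispatch-hit tgt c (suc k) (suc a) ⟨ suc a , update R 4 t ⟩ t (code-tail cd) refl (update-same R 4 t) lt)
          λ R' (h1 , h2) → h1 , λ k' nk → trans (h2 k' nk) (update-other R 4 t k' nk)))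

  dispatch-miss : ∀ tgt c k a st t → Code Ψ a (dispatchCode tgt k c) → pc st ≡ a → regs st 4 ≡ t → c ≤ t →
                  Reaches st (c + a) (λ R' → R' 4 ≡ t ∸ c × ∀ k' → k' ≢ 4 → R' k' ≡ regs st k')
  dispatch-miss tgt zero k a st t cd e e4 le = reaches-here e (e4 , λ k' _ → refl)
  dispatch-miss tgt (suc c) k a ⟨ .a , R ⟩ (suc t) cd refl e (s≤s le) =
    reaches-dec-suc (code-head cd) e
      (subst (λ z → Reaches ⟨ suc a , update R 4 t ⟩ z (λ R' → R' 4 ≡ t ∸ c × ∀ k' → k' ≢ 4 → R' k' ≡ R k')) (+-suc c a)
        (reaches-mono (dispatch-miss tgt c (suc k) (suc a) ⟨ suc a , update R 4 t ⟩ t (code-tail cd) refl (update-same R 4 t) le)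
          λ R' (h1 , h2) → h1 , λ k' nk → trans (h2 k' nk) (update-other R 4 t k' nk)))

  halve-loop : ∀ a t st → Code Ψ a (halveCode a) → pc st ≡ a → regs st 4 ≡ t → regs st 7 ≡ 0 →
               Reaches st (4 + a) (λ R' → R' 4 ≡ 0 × R' 5 ≡ regs st 5 + ⌊ t /2⌋ × ∀ k → k ≢ 4 → k ≢ 5 → R' k ≡ regs st k)
  halve-loop a zero ⟨ .a , R ⟩ cd refl e z =
    reaches-dec-zero (code-head cd) e (reaches-here refl (e , sym (+-identityʳ _) , λ k _ _ → refl))
  halve-loop a (suc zero) ⟨ .a , R ⟩ cd refl e z =
    reaches-dec-suc (code-head cd) e (reaches-dec-zero (code-head (code-tail cd)) (update-same R 4 0)
      (reaches-here refl (update-same R 4 0 , trans (update-other R 4 0 5 (λ ())) (sym (+-identityʳ _)) ,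
                          λ k n4 _ → update-other R 4 0 k n4)))
  halve-loop a (suc (suc t)) ⟨ .a , R ⟩ cd refl e z =
    reaches-dec-suc (code-head cd) e (reaches-dec-suc (code-head (code-tail cd)) (update-same R 4 (suc t))
      (reaches-step (code-head (code-tail (code-tail cd)))
        (reaches-dec-zero (code-head (code-tail (code-tail (code-tail cd)))) z3
          (reaches-mono (halve-loop a t ⟨ a , R3 ⟩ cd refl e3 z3)
            (λ R' (h1 , h2 , h3) → h1 , trans h2 (trans (cong (_+ ⌊ t /2⌋) e5) (sym (+-suc (R 5) ⌊ t /2⌋)))
                                 , λ k n4 n5 → trans (h3 k n4 n5) (f3 k n4 n5))))))
    where
    R1 : ℕ → ℕ
    R1 = update R 4 (suc t)
    R2 : ℕ → ℕ
    R2 = update R1 4 t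
    R3 : ℕ → ℕ
    R3 = update R2 5 (suc (R2 5))
    e3 : R3 4 ≡ t
    e3 = trans (update-other R2 5 (suc (R2 5)) 4 (λ ())) (update-same R1 4 t)
    f3 : ∀ k → k ≢ 4 → k ≢ 5 → R3 k ≡ R k
    f3 k n4 n5 = trans (update-other R2 5 (suc (R2 5)) k n5) (trans (update-other R1 4 t k n4) (update-other R 4 (suc t) k n4))
    z3 : R3 7 ≡ 0
    z3 = trans (f3 7 (λ ()) (λ ())) z
    e5 : R3 5 ≡ suc (R 5)
    e5 = trans (update-same R2 5 _) (cong suc (trans (update-other R1 4 t 5 (λ ())) (update-other R 4 (suc t) 5 (λ ()))))

  halve-spec : ∀ a st → Code Ψ a (halveCode a) → pc st ≡ a → regs st 5 ≡ 0 → regs st 7 ≡ 0 →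
               Reaches st (7 + a) (λ R' → R' 4 ≡ ⌊ regs st 4 /2⌋ × R' 5 ≡ 0 × ∀ k → k ≢ 4 → k ≢ 5 → R' k ≡ regs st k)
  halve-spec a st cd e z5 z =
    reaches-seq (halve-loop a (regs st 4) st cd e refl z) λ st1 e1 (h1 , h2 , h3) →
      reaches-mono (move-spec (4 + a) 5 4 (7 + a) (code-tail (code-tail (code-tail (code-tail cd)))) (λ ()) (λ ()) (λ ())
                     st1 e1 (trans (h3 7 (λ ()) (λ ())) z))
        λ R' (g1 , g2 , g3) → trans g2 (cong₂ _+_ h1 (trans h2 (cong (_+ ⌊ regs st 4 /2⌋) z5))) , g1 ,
                              λ k n4 n5 → trans (g3 k n5 n4) (h3 k n4 n5)

  shift-spec : ∀ c H st → Code Ψ H (shiftCode H) → pc st ≡ H → regs st 6 ≡ c → regs st 5 ≡ 0 → regs st 7 ≡ 0 →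
               Reaches st (9 + H) (λ R' → R' 4 ≡ shiftR c (regs st 4) × R' 5 ≡ 0 × R' 6 ≡ 0 ×
                                          ∀ k → k ≢ 4 → k ≢ 5 → k ≢ 6 → R' k ≡ regs st k)
  shift-spec zero H ⟨ .H , R ⟩ cd refl e6 e5 z =
    reaches-dec-zero (code-head cd) e6 (reaches-here refl (refl , e5 , e6 , λ k _ _ _ → refl))
  shift-spec (suc c) H ⟨ .H , R ⟩ cd refl e6 e5 z =
    reaches-dec-suc (code-head cd) e6
      (reaches-seq (halve-spec (1 + H) ⟨ 1 + H , R1 ⟩ (code-++ˡ (halveCode (1 + H)) _ (code-tail cd)) refl
                     (trans (update-other R 6 c 5 (λ ())) e5) z1)
        λ st1 e1 (h1 , h2 , h3) →
          reaches-seq (jump-spec (8 + H) H st1 (code-head (code-++ʳ (halveCode (1 + H)) (dec 7 H ∷ []) (code-tail cd))) e1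
                         (trans (h3 7 (λ ()) (λ ())) z1))
          λ st2 e2 g →
            reaches-mono (shift-spec c H st2 cd e2 (trans (g 6) (trans (h3 6 (λ ()) (λ ())) (update-same R 6 c)))
                           (trans (g 5) h2) (trans (g 7) (trans (h3 7 (λ ()) (λ ())) z1)))
            (λ R' (f1 , f2 , f3 , f4) → trans f1 (cong (shiftR c) (trans (g 4) (trans h1 (cong ⌊_/2⌋ (update-other R 6 c 4 (λ ()))))))
                                      , f2 , f3 , λ k n4 n5 n6 → trans (f4 k n4 n5 n6) (trans (g k) (trans (h3 k n4 n5) (update-other R 6 c k n6)))))
    where
    R1 : ℕ → ℕ
    R1 = update R 6 c
    z1 : R1 7 ≡ 0
    z1 = trans (update-other R 6 c 7 (λ ())) z

  odd-spec : ∀ P EV OD t st → Code Ψ P (oddCode P EV OD) → pc st ≡ P → regs st 4 ≡ t → regs st 7 ≡ 0 →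
             Reaches st (if odd t then OD else EV) (λ R' → R' 4 ≡ 0 × ∀ k → k ≢ 4 → R' k ≡ regs st k)
  odd-spec P EV OD zero ⟨ .P , R ⟩ cd refl e z =
    reaches-dec-zero (code-head cd) e (reaches-here refl (e , λ k _ → refl))
  odd-spec P EV OD (suc zero) ⟨ .P , R ⟩ cd refl e z =
    reaches-dec-suc (code-head cd) e (reaches-dec-zero (code-head (code-tail cd)) (update-same R 4 0)
      (reaches-here refl (update-same R 4 0 , λ k n → update-other R 4 0 k n)))
  odd-spec P EV OD (suc (suc t)) ⟨ .P , R ⟩ cd refl e z =
    reaches-dec-suc (code-head cd) e (reaches-dec-suc (code-head (code-tail cd)) (update-same R 4 (suc t))
      (reaches-dec-zero (code-head (code-tail (code-tail cd))) z2
        (reaches-mono (odd-spec P EV OD t ⟨ P , R2 ⟩ cd refl (update-same R1 4 t) z2)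
          (λ R' (h1 , h2) → h1 , λ k n → trans (h2 k n) (trans (update-other R1 4 t k n) (update-other R 4 (suc t) k n))))))
    where
    R1 : ℕ → ℕ
    R1 = update R 4 (suc t)
    R2 : ℕ → ℕ
    R2 = update R1 4 t
    z2 : R2 7 ≡ 0
    z2 = trans (update-other R1 4 t 7 (λ ())) (trans (update-other R 4 (suc t) 7 (λ ())) z)

-- With q in register Rr and j in register 2, sets register Rr to 1 if bit q of j is set and
-- q ∈ X, and to 0 otherwise.
bitAnswerCode : ℕ → ℕ → List Instr
bitAnswerCode BIT Rr = drainCode (26 + BIT) Rr [] (28 + BIT) ++ (dec 7 (30 + BIT) ∷ orc Rr ∷ [])

bitQueryCode : ℕ → ℕ → List Instr
bitQueryCode BIT Rr = copyCode BIT Rr 6 5 ++ copyCode (7 + BIT) 2 4 5 ++ shiftCode (14 + BIT) ++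
                      oddCode (23 + BIT) (26 + BIT) (29 + BIT) ++ bitAnswerCode BIT Rr

queryTail : ℕ → ℕ → List Instr
queryTail c Rr = drainCode c 4 [] (2 + c) ++ (dec 7 (7 + c) ∷
                 (drainCode (3 + c) Rr [] (5 + c) ++ (inc Rr ∷ dec 7 (37 + c) ∷ bitQueryCode (7 + c) Rr)))

dispatchTarget : SetN → ℕ → ℕ → ℕ
dispatchTarget F c k = if F k then 3 + c else 7 + c

simulatedOracle : SetN → SetN → ℕ → SetN
simulatedOracle F X j q = F q ∨ (odd (shiftR q j) ∧ X q)

-- Replaces the query q in register Rr by its answer under simulatedOracle F X j; membership
-- in F matters only below b, where it is hard-wired by a dispatch on q.
queryCode : SetN → ℕ → ℕ → ℕ → List Instr
queryCode F b a Rr = copyCode a Rr 4 5 ++ (dispatchCode (dispatchTarget F (b + (7 + a))) 0 b ++ queryTail (b + (7 + a)) Rr)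

module Query (Ψ : Program) (X : SetN) where
  open Macros Ψ X

  agree-at : ∀ (R0 R1 : ℕ → ℕ) x → R1 x ≡ R0 x → ∀ k → (k ≢ x → R1 k ≡ R0 k) → R1 k ≡ R0 k
  agree-at R0 R1 x e k f with k ≟ x
  ... | yes refl = e
  ... | no n = f n

  FrameExcept : ℕ → (ℕ → ℕ) → (ℕ → ℕ) → Set
  FrameExcept Rr R0 R1 = ∀ k → k ≢ Rr → k ≢ 4 → k ≢ 5 → k ≢ 6 → R1 k ≡ R0 k

  frame-trans : ∀ {Rr R0 R1 R2} → FrameExcept Rr R0 R1 → FrameExcept Rr R1 R2 → FrameExcept Rr R0 R2
  frame-trans f g k a b c d = trans (g k a b c d) (f k a b c d)

  QueryAnswered : ℕ → Bool → (ℕ → ℕ) → (ℕ → ℕ) → Set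
  QueryAnswered Rr v R R' = R' Rr ≡ (if v then 1 else 0) × R' 4 ≡ 0 × R' 5 ≡ 0 × R' 6 ≡ 0 × FrameExcept Rr R R'

  bitQuery-answer : ∀ BIT r v st → Code Ψ (26 + BIT) (bitAnswerCode BIT (8 + r)) →
                    pc st ≡ (if v then 29 + BIT else 26 + BIT) →
                    regs st 4 ≡ 0 → regs st 5 ≡ 0 → regs st 6 ≡ 0 → regs st 7 ≡ 0 →
                    Reaches st (30 + BIT) (QueryAnswered (8 + r) (v ∧ X (regs st (8 + r))) (regs st))
  bitQuery-answer BIT r false st cd e z4 z5 z6 z7 =
    reaches-seq (clear-spec (26 + BIT) (8 + r) (28 + BIT) (code-++ˡ (drainCode (26 + BIT) (8 + r) [] (28 + BIT)) _ cd) (λ ()) st e z7)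
      λ st1 e1 (h1 , h2) →
        reaches-mono (jump-spec (28 + BIT) (30 + BIT) st1 (code-head (code-++ʳ (drainCode (26 + BIT) (8 + r) [] (28 + BIT)) _ cd))
                       e1 (trans (h2 7 (λ ())) z7))
          λ R' hh → trans (hh (8 + r)) h1
                  , trans (hh 4) (trans (h2 4 (λ ())) z4) , trans (hh 5) (trans (h2 5 (λ ())) z5) , trans (hh 6) (trans (h2 6 (λ ())) z6)
                  , λ k nr _ _ _ → trans (hh k) (h2 k nr)
  bitQuery-answer BIT r true ⟨ .(29 + BIT) , R ⟩ cd refl z4 z5 z6 z7 =
    reaches-step (code-head (code-tail (code-++ʳ (drainCode (26 + BIT) (8 + r) [] (28 + BIT)) _ cd)))
      (reaches-here refl (update-same R (8 + r) v , trans (update-other R (8 + r) v 4 (λ ())) z4 ,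
                          trans (update-other R (8 + r) v 5 (λ ())) z5 , trans (update-other R (8 + r) v 6 (λ ())) z6 ,
                          λ k nr _ _ _ → update-other R (8 + r) v k nr))
    where
    v : ℕ
    v = if X (R (8 + r)) then 1 else 0

  bitQuery-spec : ∀ BIT r st → Code Ψ BIT (bitQueryCode BIT (8 + r)) → pc st ≡ BIT →
                  regs st 4 ≡ 0 → regs st 5 ≡ 0 → regs st 6 ≡ 0 → regs st 7 ≡ 0 →
                  Reaches st (30 + BIT) (QueryAnswered (8 + r) (odd (shiftR (regs st (8 + r)) (regs st 2)) ∧ X (regs st (8 + r))) (regs st))
  bitQuery-spec BIT r st cd e z4 z5 z6 z7 =
    reaches-seq (copy-spec BIT Rr 6 5 c1 (λ ()) (λ ()) (λ ()) (λ ()) (λ ()) (λ ()) st e z7 z5) λ st1 e1 (a1 , a2 , a3 , a4) →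
    reaches-seq (copy-spec (7 + BIT) 2 4 5 c2 (λ ()) (λ ()) (λ ()) (λ ()) (λ ()) (λ ()) st1 e1 (trans (a4 7 (λ ()) (λ ()) (λ ())) z7) a3)
      λ st2 e2 (b1 , b2 , b3 , b4) →
    reaches-seq (shift-spec q (14 + BIT) st2 c3 e2 (trans (b4 6 (λ ()) (λ ()) (λ ())) (trans a2 (cong (_+ q) z6))) b3
                  (trans (b4 7 (λ ()) (λ ()) (λ ())) (trans (a4 7 (λ ()) (λ ()) (λ ())) z7))) λ st3 e3 (d1 , d2 , d3 , d4) →
    let t4 : regs st3 4 ≡ shiftR q j
        t4 = trans d1 (cong (shiftR q) (trans b2 (trans (cong (_+ regs st1 2) (trans (a4 4 (λ ()) (λ ()) (λ ())) z4)) (a4 2 (λ ()) (λ ()) (λ ())))))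
        z73 : regs st3 7 ≡ 0
        z73 = trans (d4 7 (λ ()) (λ ()) (λ ())) (trans (b4 7 (λ ()) (λ ()) (λ ())) (trans (a4 7 (λ ()) (λ ()) (λ ())) z7))
        fr3 : ∀ k → k ≢ 4 → k ≢ 5 → k ≢ 6 → regs st3 k ≡ regs st k
        fr3 k n4 n5 n6 = trans (d4 k n4 n5 n6) (trans (agree-at (regs st1) (regs st2) 2 b1 k (λ n2 → b4 k n2 n4 n5))
                                                         (agree-at (regs st) (regs st1) Rr a1 k (λ nr → a4 k nr n6 n5)))
    in reaches-seq (odd-spec (23 + BIT) (26 + BIT) (29 + BIT) (shiftR q j) st3 c4 e3 t4 z73) λ st4 e4 (f1 , f2) →
       reaches-mono (bitQuery-answer BIT r (odd (shiftR q j)) st4 cd5 e4 f1 (trans (f2 5 (λ ())) d2) (trans (f2 6 (λ ())) d3)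
                                     (trans (f2 7 (λ ())) z73))
         λ R' (h1 , h2 , h3 , h4 , h5) →
           trans h1 (cong (λ z → if odd (shiftR q j) ∧ X z then 1 else 0) (trans (f2 Rr (λ ())) (fr3 Rr (λ ()) (λ ()) (λ ()))))
           , h2 , h3 , h4 , frame-trans (λ k _ n4 n5 n6 → trans (f2 k n4) (fr3 k n4 n5 n6)) h5
    where
    Rr : ℕ
    Rr = 8 + r
    q : ℕ
    q = regs st Rr
    j : ℕ
    j = regs st 2
    c1 : Code Ψ BIT (copyCode BIT Rr 6 5)
    c1 = code-++ˡ (copyCode BIT Rr 6 5) _ cd
    cd2 : Code Ψ (7 + BIT) (copyCode (7 + BIT) 2 4 5 ++ shiftCode (14 + BIT) ++ oddCode (23 + BIT) (26 + BIT) (29 + BIT) ++ bitAnswerCode BIT Rr)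
    cd2 = code-++ʳ (copyCode BIT Rr 6 5) _ cd
    c2 : Code Ψ (7 + BIT) (copyCode (7 + BIT) 2 4 5)
    c2 = code-++ˡ (copyCode (7 + BIT) 2 4 5) _ cd2
    cd3 : Code Ψ (14 + BIT) (shiftCode (14 + BIT) ++ oddCode (23 + BIT) (26 + BIT) (29 + BIT) ++ bitAnswerCode BIT Rr)
    cd3 = code-++ʳ (copyCode (7 + BIT) 2 4 5) _ cd2
    c3 : Code Ψ (14 + BIT) (shiftCode (14 + BIT))
    c3 = code-++ˡ (shiftCode (14 + BIT)) _ cd3
    cd4 : Code Ψ (23 + BIT) (oddCode (23 + BIT) (26 + BIT) (29 + BIT) ++ bitAnswerCode BIT Rr)
    cd4 = code-++ʳ (shiftCode (14 + BIT)) _ cd3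
    c4 : Code Ψ (23 + BIT) (oddCode (23 + BIT) (26 + BIT) (29 + BIT))
    c4 = code-++ˡ (oddCode (23 + BIT) (26 + BIT) (29 + BIT)) _ cd4
    cd5 : Code Ψ (26 + BIT) (bitAnswerCode BIT Rr)
    cd5 = code-++ʳ (oddCode (23 + BIT) (26 + BIT) (29 + BIT)) _ cd4

  query-in-F : ∀ c r st {xs} → Code Ψ (3 + c) (drainCode (3 + c) (8 + r) [] (5 + c) ++ inc (8 + r) ∷ dec 7 (37 + c) ∷ xs) →
               pc st ≡ 3 + c → regs st 7 ≡ 0 →
               Reaches st (37 + c) (λ R' → R' (8 + r) ≡ 1 × ∀ k → k ≢ 8 + r → R' k ≡ regs st k)
  query-in-F c r st {xs} cd e z =
    reaches-seq (clear-spec (3 + c) (8 + r) (5 + c) (code-++ˡ (drainCode (3 + c) (8 + r) [] (5 + c)) _ cd) (λ ()) st e z)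
      λ st1 e1 (g1 , g2) →
    reaches-seq (inc-spec (5 + c) (8 + r) st1 (code-head rest) e1) λ st2 e2 (k1 , k2) →
    reaches-mono (jump-spec (6 + c) (37 + c) st2 (code-head (code-tail rest)) e2 (trans (k2 7 (λ ())) (trans (g2 7 (λ ())) z)))
      λ R' h → trans (h (8 + r)) (trans k1 (cong suc g1)) , λ k nr → trans (h k) (trans (k2 k nr) (g2 k nr))
    where
    rest : Code Ψ (5 + c) (inc (8 + r) ∷ dec 7 (37 + c) ∷ xs)
    rest = code-++ʳ (drainCode (3 + c) (8 + r) [] (5 + c)) _ cd

  query-spec : ∀ F b → (∀ x → b ≤ x → F x ≡ false) → ∀ a r st → Code Ψ a (queryCode F b a (8 + r)) → pc st ≡ a →
               regs st 4 ≡ 0 → regs st 5 ≡ 0 → regs st 6 ≡ 0 → regs st 7 ≡ 0 →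
               Reaches st (37 + (b + (7 + a)))
                 (QueryAnswered (8 + r) (simulatedOracle F X (regs st 2) (regs st (8 + r))) (regs st))
  query-spec F b F-bounded a r st cd e z4 z5 z6 z7 =
    reaches-seq (copy-spec a Rr 4 5 cCopy (λ ()) (λ ()) (λ ()) (λ ()) (λ ()) (λ ()) st e z7 z5) λ st1 e1 (a1 , a2 , a3 , a4) →
      after-copy (q <? b) st1 e1 (trans a2 (cong (_+ q) z4)) a3 (trans (a4 6 (λ ()) (λ ()) (λ ())) z6)
                 (trans (a4 7 (λ ()) (λ ()) (λ ())) z7) a1 (a4 2 (λ ()) (λ ()) (λ ())) (λ k nr n4 n5 _ → a4 k nr n4 n5)
    where
    Rr : ℕ
    Rr = 8 + r
    q : ℕ
    q = regs st Rr
    j : ℕ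
    j = regs st 2
    c : ℕ
    c = b + (7 + a)
    Post : (ℕ → ℕ) → Set
    Post = QueryAnswered Rr (simulatedOracle F X j q) (regs st)
    cCopy : Code Ψ a (copyCode a Rr 4 5)
    cCopy = code-++ˡ (copyCode a Rr 4 5) _ cd
    cDispatch : Code Ψ (7 + a) (dispatchCode (dispatchTarget F c) 0 b)
    cDispatch = code-++ˡ (dispatchCode (dispatchTarget F c) 0 b) (queryTail c Rr) (code-++ʳ (copyCode a Rr 4 5) _ cd)
    cTail : Code Ψ c (queryTail c Rr)
    cTail = subst (λ z → Code Ψ (z + (7 + a)) (queryTail c Rr)) (length-dispatchCode (dispatchTarget F c) 0 b)
              (code-++ʳ (dispatchCode (dispatchTarget F c) 0 b) (queryTail c Rr) (code-++ʳ (copyCode a Rr 4 5) _ cd))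
    cClear4 : Code Ψ c (drainCode c 4 [] (2 + c))
    cClear4 = code-++ˡ (drainCode c 4 [] (2 + c)) _ cTail
    cJump : Code Ψ (2 + c) (dec 7 (7 + c) ∷ drainCode (3 + c) Rr [] (5 + c) ++ inc Rr ∷ dec 7 (37 + c) ∷ bitQueryCode (7 + c) Rr)
    cJump = code-++ʳ (drainCode c 4 [] (2 + c)) _ cTail
    cInF : Code Ψ (3 + c) (drainCode (3 + c) Rr [] (5 + c) ++ inc Rr ∷ dec 7 (37 + c) ∷ bitQueryCode (7 + c) Rr)
    cInF = code-tail cJump
    cBit : Code Ψ (7 + c) (bitQueryCode (7 + c) Rr)
    cBit = code-tail (code-tail (code-++ʳ (drainCode (3 + c) Rr [] (5 + c)) _ cInF))

    State0 : State → Set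
    State0 st' = regs st' 4 ≡ 0 × regs st' 5 ≡ 0 × regs st' 6 ≡ 0 × regs st' 7 ≡ 0 ×
                 regs st' Rr ≡ q × regs st' 2 ≡ j × FrameExcept Rr (regs st) (regs st')

    via-bit : ∀ st2 → pc st2 ≡ 7 + c → State0 st2 → F q ≡ false → Reaches st2 (37 + c) Post
    via-bit st2 e2 (y4 , y5 , y6 , y7 , yr , yj , fr) fq =
      reaches-mono (bitQuery-spec (7 + c) r st2 cBit e2 y4 y5 y6 y7) λ R' (h1 , h2 , h3 , h4 , h5) →
        trans h1 (trans (cong₂ (λ u v → if odd (shiftR u v) ∧ X u then 1 else 0) yr yj)
                        (cong (λ z → if z ∨ (odd (shiftR q j) ∧ X q) then 1 else 0) (sym fq)))
        , h2 , h3 , h4 , frame-trans fr h5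

    via-F : ∀ st2 → pc st2 ≡ 3 + c → State0 st2 → F q ≡ true → Reaches st2 (37 + c) Post
    via-F st2 e2 (y4 , y5 , y6 , y7 , yr , yj , fr) fq =
      reaches-mono (query-in-F c r st2 cInF e2 y7) λ R' (h1 , h2) →
        trans h1 (cong (λ z → if z ∨ (odd (shiftR q j) ∧ X q) then 1 else 0) (sym fq))
        , trans (h2 4 (λ ())) y4 , trans (h2 5 (λ ())) y5 , trans (h2 6 (λ ())) y6
        , frame-trans fr (λ k nr _ _ _ → h2 k nr)

    dispatched : ∀ v → F q ≡ v → ∀ st2 → pc st2 ≡ (if v then 3 + c else 7 + c) → State0 st2 → Reaches st2 (37 + c) Post
    dispatched false fq st2 e2 s2 = via-bit st2 e2 s2 fq
    dispatched true fq st2 e2 s2 = via-F st2 e2 s2 fq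

    after-copy : Dec (q < b) → ∀ st1 → pc st1 ≡ 7 + a → regs st1 4 ≡ q → regs st1 5 ≡ 0 → regs st1 6 ≡ 0 → regs st1 7 ≡ 0 →
                 regs st1 Rr ≡ q → regs st1 2 ≡ j → FrameExcept Rr (regs st) (regs st1) → Reaches st1 (37 + c) Post
    after-copy (no q≮b) st1 e1 t1 y5 y6 y7 yr yj fr =
      reaches-seq (dispatch-miss (dispatchTarget F c) b 0 (7 + a) st1 q cDispatch e1 t1 (≮⇒≥ q≮b)) λ st2 e2 (h1 , h2) →
      reaches-seq (clear-spec c 4 (2 + c) cClear4 (λ ()) st2 e2 (trans (h2 7 (λ ())) y7)) λ st3 e3 (g1 , g2) →
      reaches-seq (jump-spec (2 + c) (7 + c) st3 (code-head cJump) e3 (trans (g2 7 (λ ())) (trans (h2 7 (λ ())) y7))) λ st4 e4 k4 →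
      let kept : ∀ k {w} → k ≢ 4 → regs st1 k ≡ w → regs st4 k ≡ w
          kept k n e = trans (k4 k) (trans (g2 k n) (trans (h2 k n) e))
      in via-bit st4 e4 (trans (k4 4) g1 , kept 5 (λ ()) y5 , kept 6 (λ ()) y6 , kept 7 (λ ()) y7 , kept Rr (λ ()) yr ,
                         kept 2 (λ ()) yj , frame-trans fr (λ k nr n4 n5 n6 → kept k n4 refl))
                 (F-bounded q (≮⇒≥ q≮b))
    after-copy (yes q<b) st1 e1 t1 y5 y6 y7 yr yj fr =
      reaches-seq (dispatch-hit (dispatchTarget F c) b 0 (7 + a) st1 q cDispatch e1 t1 q<b) λ st2 e2 (h1 , h2) →
        dispatched (F q) refl st2 (trans e2 (cong (dispatchTarget F c) (+-identityʳ q)))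
          (h1 , trans (h2 5 (λ ())) y5 , trans (h2 6 (λ ())) y6 , trans (h2 7 (λ ())) y7 , trans (h2 Rr (λ ())) yr ,
           trans (h2 2 (λ ())) yj , frame-trans fr (λ k nr n4 n5 n6 → h2 k n4))

-- The uniform functional

register : Instr → ℕ
register (inc r) = r
register (dec r j) = r
register (orc r) = r

maxRegister : Program → ℕ
maxRegister [] = 0
maxRegister (i ∷ is) = register i ⊔ maxRegister is

register≤maxRegister : ∀ p k i → fetch p k ≡ just i → register i ≤ maxRegister p
register≤maxRegister (x ∷ p) zero .x refl = m≤m⊔n (register x) (maxRegister p)
register≤maxRegister (x ∷ p) (suc k) i e = ≤-trans (register≤maxRegister p k i e) (m≤n⊔m (register x) (maxRegister p))

fetch-nothing⇒length≤ : ∀ (p : Program) k → fetch p k ≡ nothing → length p ≤ k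
fetch-nothing⇒length≤ [] k e = z≤n
fetch-nothing⇒length≤ (x ∷ p) zero ()
fetch-nothing⇒length≤ (x ∷ p) (suc k) e = s≤s (fetch-nothing⇒length≤ p k e)

module Compiler (p : Program) (F : SetN) (b : ℕ) where

  regCount : ℕ
  regCount = suc (maxRegister p)

  blockSize : Instr → ℕ
  blockSize (inc r) = 2
  blockSize (dec r j) = 2
  blockSize (orc r) = 45 + b

  -- offset k p is the address of the k-th block of body relative to BODY; it stays constant
  -- from k = length p on, so a jump out of p lands at END, where p has halted.
  offset : ℕ → Program → ℕ
  offset zero is = 0
  offset (suc k) [] = 0
  offset (suc k) (i ∷ is) = blockSize i + offset k is

  LOAD : ℕ
  LOAD = (regCount + regCount) + 5

  BODY : ℕ
  BODY = 14 + LOAD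

  addr : ℕ → ℕ
  addr k = offset k p + BODY

  END : ℕ
  END = addr (length p)

  block : ℕ → Instr → List Instr
  block a (inc r) = dec 3 3 ∷ inc (8 + r) ∷ []
  block a (dec r j) = dec 3 3 ∷ dec (8 + r) (addr j) ∷ []
  block a (orc r) = dec 3 3 ∷ queryCode F b (suc a) (8 + r)

  body : ℕ → Program → List Instr
  body a [] = []
  body a (i ∷ is) = block a i ++ body (blockSize i + a) is

  clearAll : ℕ → ℕ → ℕ → List Instr
  clearAll a k zero = []
  clearAll a k (suc c) = drainCode a (8 + k) [] (2 + a) ++ clearAll (2 + a) (suc k) c

  -- Registers of Ψ: 0 input and output, 1 the saved input n, 2 the current j, 3 the remaining
  -- fuel, 4–6 scratch, 7 constantly 0, 8 + r the simulated register r of p.  After saving n,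
  -- each round clears the simulated registers, loads n and the fuel j, and runs body, in
  -- which every simulated instruction first spends one unit of fuel; running out (`dec 3 3`)
  -- jumps to address 3, which increments j and starts the next round.  When p halts, its
  -- output register 8 is moved to register 0.
  Ψ : Program
  Ψ = drainCode 0 0 (1 ∷ []) 5 ++ (inc 2 ∷ dec 7 5 ∷ [] ++ (clearAll 5 0 regCount ++
      (copyCode LOAD 1 8 4 ++ copyCode (7 + LOAD) 2 3 4 ++
      (body BODY p ++ drainCode END 8 (0 ∷ []) (3 + END)))))

  length-block : ∀ a i → length (block a i) ≡ blockSize i
  length-block a (inc r) = refl
  length-block a (dec r j) = refl
  length-block a (orc r) = cong suc (cong (7 +_) (trans (length-++ (dispatchCode (dispatchTarget F c) 0 b) {queryTail c (8 + r)})
                                    (trans (cong (_+ 37) (length-dispatchCode (dispatchTarget F c) 0 b)) (+-comm b 37))))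
    where
    c : ℕ
    c = b + (7 + suc a)

  length-body : ∀ a is → length (body a is) ≡ offset (length is) is
  length-body a [] = refl
  length-body a (i ∷ is) = trans (length-++ (block a i)) (cong₂ _+_ (length-block a i) (length-body (blockSize i + a) is))

  offset-suc : ∀ is k i → fetch is k ≡ just i → offset (suc k) is ≡ offset k is + blockSize i
  offset-suc (x ∷ is) zero .x refl = +-comm (blockSize x) 0
  offset-suc (x ∷ is) (suc k) i e = trans (cong (blockSize x +_) (offset-suc is k i e)) (sym (+-assoc (blockSize x) (offset k is) (blockSize i)))

  offset-past-end : ∀ is k → length is ≤ k → offset k is ≡ offset (length is) is
  offset-past-end [] zero _ = refl
  offset-past-end [] (suc k) _ = refl
  offset-past-end (x ∷ is) (suc k) (s≤s le) = cong (blockSize x +_) (offset-past-end is k le)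

  body-block : ∀ {Q} is a k i → Code Q a (body a is) → fetch is k ≡ just i → Code Q (offset k is + a) (block (offset k is + a) i)
  body-block (x ∷ is) a zero .x c refl = code-++ˡ (block a x) _ c
  body-block {Q} (x ∷ is) a (suc k) i c e =
    subst (λ z → Code Q z (block z i)) (trans (sym (+-assoc (offset k is) (blockSize x) a)) (cong (_+ a) (+-comm (offset k is) (blockSize x))))
      (body-block is (blockSize x + a) k i (subst (λ z → Code Q (z + a) (body (blockSize x + a) is)) (length-block a x) (code-++ʳ (block a x) _ c)) e)

  clearAllEnd : ℕ → ℕ → ℕ
  clearAllEnd zero a = a
  clearAllEnd (suc c) a = clearAllEnd c (2 + a)

  clearAllEnd≡ : ∀ c a → clearAllEnd c a ≡ (c + c) + a
  clearAllEnd≡ zero a = refl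
  clearAllEnd≡ (suc c) a = trans (clearAllEnd≡ c (2 + a)) (rearrange c a)
    where
    rearrange : ∀ c a → c + c + (2 + a) ≡ suc c + suc c + a
    rearrange = solve-∀

  length-clearAll : ∀ a k c → length (clearAll a k c) ≡ c + c
  length-clearAll a k zero = refl
  length-clearAll a k (suc c) = trans (cong (2 +_) (length-clearAll (2 + a) (suc k) c)) (cong suc (sym (+-suc c c)))

  module _ (X : SetN) where
    open Macros Ψ X

    clearAll-spec : ∀ c k a st → Code Ψ a (clearAll a k c) → pc st ≡ a → regs st 7 ≡ 0 →
              Reaches st (clearAllEnd c a) (λ R' → (∀ i → k ≤ i → i < c + k → R' (8 + i) ≡ 0) × (∀ x → x < 8 + k → R' x ≡ regs st x))
    clearAll-spec zero k a st cd e z = reaches-here e ((λ i k≤i i<k → ⊥-elim (<-irrefl refl (≤-<-trans k≤i i<k))) , λ x _ → refl)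
    clearAll-spec (suc c) k a st cd e z =
      reaches-seq (clear-spec a (8 + k) (2 + a) (code-++ˡ (drainCode a (8 + k) [] (2 + a)) _ cd) (λ ()) st e z) λ st1 e1 (h1 , h2) →
        reaches-mono (clearAll-spec c (suc k) (2 + a) st1 (code-++ʳ (drainCode a (8 + k) [] (2 + a)) _ cd) e1 (trans (h2 7 (λ ())) z))
          λ R' (g1 , g2) → (λ i k≤i i<ck → cleared R' (regs st1) g1 g2 h1 i k≤i (subst (i <_) (sym (+-suc c k)) i<ck))
                         , λ x x<8k → trans (g2 x (≤-trans x<8k (n≤1+n _))) (h2 x (λ ex → <-irrefl ex x<8k))
      where
      cleared : ∀ R' R1 → (∀ i → suc k ≤ i → i < c + suc k → R' (8 + i) ≡ 0) → (∀ x → x < 8 + suc k → R' x ≡ R1 x) →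
                R1 (8 + k) ≡ 0 →
            ∀ i → k ≤ i → i < c + suc k → R' (8 + i) ≡ 0
      cleared R' R1 g1 g2 h1 i k≤i i< with k ≟ i
      ... | yes refl = trans (g2 (8 + k) ≤-refl) h1
      ... | no ne = g1 i (≤∧≢⇒< k≤i ne) i<

  Loads : List Instr
  Loads = copyCode LOAD 1 8 4 ++ copyCode (7 + LOAD) 2 3 4 ++ (body BODY p ++ drainCode END 8 (0 ∷ []) (3 + END))
  cSave : Code Ψ 0 (drainCode 0 0 (1 ∷ []) 5)
  cSave = code-++ˡ (drainCode 0 0 (1 ∷ []) 5) _ (code-self Ψ)
  cRetry : Code Ψ 3 (inc 2 ∷ dec 7 5 ∷ clearAll 5 0 regCount ++ Loads)
  cRetry = code-++ʳ (drainCode 0 0 (1 ∷ []) 5) _ (code-self Ψ)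
  rest₁ : Code Ψ 5 (clearAll 5 0 regCount ++ Loads)
  rest₁ = code-tail (code-tail cRetry)
  cClear : Code Ψ 5 (clearAll 5 0 regCount)
  cClear = code-++ˡ (clearAll 5 0 regCount) _ rest₁
  rest₂ : Code Ψ LOAD Loads
  rest₂ = subst (λ z → Code Ψ (z + 5) Loads) (length-clearAll 5 0 regCount) (code-++ʳ (clearAll 5 0 regCount) _ rest₁)
  cLoadInput : Code Ψ LOAD (copyCode LOAD 1 8 4)
  cLoadInput = code-++ˡ (copyCode LOAD 1 8 4) _ rest₂
  rest₃ : Code Ψ (7 + LOAD) (copyCode (7 + LOAD) 2 3 4 ++ body BODY p ++ drainCode END 8 (0 ∷ []) (3 + END))
  rest₃ = code-++ʳ (copyCode LOAD 1 8 4) _ rest₂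
  cLoadFuel : Code Ψ (7 + LOAD) (copyCode (7 + LOAD) 2 3 4)
  cLoadFuel = code-++ˡ (copyCode (7 + LOAD) 2 3 4) _ rest₃
  rest₄ : Code Ψ BODY (body BODY p ++ drainCode END 8 (0 ∷ []) (3 + END))
  rest₄ = code-++ʳ (copyCode (7 + LOAD) 2 3 4) _ rest₃
  cBody : Code Ψ BODY (body BODY p)
  cBody = code-++ˡ (body BODY p) _ rest₄
  cEnd : Code Ψ END (drainCode END 8 (0 ∷ []) (3 + END))
  cEnd = subst (λ z → Code Ψ (z + BODY) (drainCode END 8 (0 ∷ []) (3 + END))) (length-body BODY p) (code-++ʳ (body BODY p) _ rest₄)

  length-Ψ : length Ψ ≡ 3 + END
  length-Ψ = trans (cong (5 +_) (length-++ (clearAll 5 0 regCount)))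
         (trans (cong (λ z → 5 + (z + (14 + length (body BODY p ++ drainCode END 8 (0 ∷ []) (3 + END))))) (length-clearAll 5 0 regCount))
         (trans (cong (λ z → 5 + ((regCount + regCount) + (14 + z))) (length-++ (body BODY p)))
         (trans (cong (λ z → 5 + ((regCount + regCount) + (14 + (z + 3)))) (length-body BODY p))
         (rearrange (regCount + regCount) (offset (length p) p)))))
    where
    rearrange : ∀ x y → 5 + (x + (14 + (y + 3))) ≡ 3 + (y + (14 + (x + 5)))
    rearrange = solve-∀

  addr-suc : ∀ k i → fetch p k ≡ just i → addr (suc k) ≡ blockSize i + addr k
  addr-suc k i fe = begin
    offset (suc k) p + BODY          ≡⟨ cong (_+ BODY) (offset-suc p k i fe) ⟩
    offset k p + blockSize i + BODY  ≡⟨ cong (_+ BODY) (+-comm (offset k p) (blockSize i)) ⟩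
    blockSize i + offset k p + BODY  ≡⟨ +-assoc (blockSize i) (offset k p) BODY ⟩
    blockSize i + addr k             ∎
    where open ≡-Reasoning

module Simulation (p : Program) (F : SetN) (b : ℕ) (F-bounded : ∀ x → b ≤ x → F x ≡ false) (X : SetN) (n : ℕ) where
  open Compiler p F b
  open Macros Ψ X
  open Query Ψ X

  record Bookkeeping (j f : ℕ) (R : ℕ → ℕ) : Set where
    constructor bk
    field
      reg0 : R 0 ≡ 0
      reg1 : R 1 ≡ n
      reg2 : R 2 ≡ j
      reg3 : R 3 ≡ f
      reg4 : R 4 ≡ 0
      reg5 : R 5 ≡ 0
      reg6 : R 6 ≡ 0
      reg7 : R 7 ≡ 0
  open Bookkeeping

  Mirrors : (ℕ → ℕ) → (ℕ → ℕ) → Set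
  Mirrors Rσ R = ∀ k → k < regCount → Rσ (8 + k) ≡ R k

  record SimInv (j f : ℕ) (st σ : State) : Set where
    constructor si
    field
      spc : pc σ ≡ addr (pc st)
      sbk : Bookkeeping j f (regs σ)
      sag : Mirrors (regs σ) (regs st)
  open SimInv

  SimOut : ℕ → Maybe State → State → Set
  SimOut j (just st') σ = Reaches σ (3 + END) (λ R' → R' 0 ≡ regs st' 0)
  SimOut j nothing σ = Reaches σ 5 (Bookkeeping (suc j) 0)

  block-head : ∀ a i → Code Ψ a (block a i) → fetch Ψ a ≡ just (dec 3 3)
  block-head a (inc r) c = code-head c
  block-head a (dec r j) c = code-head c
  block-head a (orc r) c = code-head c

  end-spec : ∀ σ → pc σ ≡ END → regs σ 0 ≡ 0 → regs σ 7 ≡ 0 → Reaches σ (3 + END) (λ R' → R' 0 ≡ regs σ 8)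
  end-spec σ e z0 z7 = reaches-mono (move-spec END 8 0 (3 + END) cEnd (λ ()) (λ ()) (λ ()) σ e z7)
    λ R' (h1 , h2 , h3) → trans h2 (cong (_+ regs σ 8) z0)

  timeout-spec : ∀ j σ → pc σ ≡ 3 → Bookkeeping j 0 (regs σ) → Reaches σ 5 (Bookkeeping (suc j) 0)
  timeout-spec j ⟨ .3 , R ⟩ refl B =
    reaches-step (code-head cRetry) (reaches-dec-zero (code-head (code-tail cRetry)) (kept 7 (λ ()) (reg7 B))
      (reaches-here refl (bk (kept 0 (λ ()) (reg0 B)) (kept 1 (λ ()) (reg1 B)) (trans (update-same R 2 (suc (R 2))) (cong suc (reg2 B)))
                             (kept 3 (λ ()) (reg3 B)) (kept 4 (λ ()) (reg4 B)) (kept 5 (λ ()) (reg5 B))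
                             (kept 6 (λ ()) (reg6 B)) (kept 7 (λ ()) (reg7 B)))))
    where
    kept : ∀ x {w} → x ≢ 2 → R x ≡ w → update R 2 (suc (R 2)) x ≡ w
    kept x n e = trans (update-other R 2 (suc (R 2)) x n) e

  init-spec : Reaches (initial n) 5 (Bookkeeping 0 0)
  init-spec = reaches-mono (move-spec 0 0 1 5 cSave (λ ()) (λ ()) (λ ()) (initial n) refl refl)
    λ R' (h1 , h2 , h3) → bk h1 h2 (h3 2 (λ ()) (λ ())) (h3 3 (λ ()) (λ ())) (h3 4 (λ ()) (λ ())) (h3 5 (λ ()) (λ ()))
                             (h3 6 (λ ()) (λ ())) (h3 7 (λ ()) (λ ()))

  round-start-spec : ∀ j σ → pc σ ≡ 5 → Bookkeeping j 0 (regs σ) → Reaches σ BODY (λ R' → Bookkeeping j j R' × Mirrors R' (regs (initial n)))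
  round-start-spec j σ e B =
    reaches-seq (clearAll-spec X regCount 0 5 σ cClear e (reg7 B)) λ st1 e1 (h1 , h2) →
    reaches-seq (copy-spec LOAD 1 8 4 cLoadInput (λ ()) (λ ()) (λ ()) (λ ()) (λ ()) (λ ()) st1 (trans e1 (clearAllEnd≡ regCount 5))
               (trans (h2 7 (<ᵇ⇒< 7 8 _)) (reg7 B))
               (trans (h2 4 (<ᵇ⇒< 4 8 _)) (reg4 B))) λ st2 e2 (g1 , g2 , g3 , g4) →
    reaches-mono (copy-spec (7 + LOAD) 2 3 4 cLoadFuel (λ ()) (λ ()) (λ ()) (λ ()) (λ ()) (λ ()) st2 e2
                   (trans (g4 7 (λ ()) (λ ()) (λ ())) (trans (h2 7 (<ᵇ⇒< 7 8 _)) (reg7 B))) g3)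
      λ R' (k1 , k2 , k3 , k4) →
        let fr : ∀ x → x < 8 → x ≢ 1 → x ≢ 4 → x ≢ 2 → x ≢ 3 → R' x ≡ regs σ x
            fr x lt n1 n4 n2 n3 = trans (k4 x n2 n3 n4) (trans (g4 x n1 (λ ex → <-irrefl ex lt) n4) (h2 x lt))
        in bk (fr 0 (<ᵇ⇒< 0 8 _) (λ ()) (λ ()) (λ ()) (λ ()) ∙ reg0 B)
              (k4 1 (λ ()) (λ ()) (λ ()) ∙ (g1 ∙ (h2 1 (<ᵇ⇒< 1 8 _) ∙ reg1 B)))
              (k1 ∙ (g4 2 (λ ()) (λ ()) (λ ()) ∙ (h2 2 (<ᵇ⇒< 2 8 _) ∙ reg2 B)))
              (k2 ∙ (cong₂ _+_ (g4 3 (λ ()) (λ ()) (λ ()) ∙ (h2 3 (<ᵇ⇒< 3 8 _) ∙ reg3 B))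
                               (g4 2 (λ ()) (λ ()) (λ ()) ∙ (h2 2 (<ᵇ⇒< 2 8 _) ∙ reg2 B))))
              k3
              (fr 5 (<ᵇ⇒< 5 8 _) (λ ()) (λ ()) (λ ()) (λ ()) ∙ reg5 B)
              (fr 6 (<ᵇ⇒< 6 8 _) (λ ()) (λ ()) (λ ()) (λ ()) ∙ reg6 B)
              (fr 7 (<ᵇ⇒< 7 8 _) (λ ()) (λ ()) (λ ()) (λ ()) ∙ reg7 B)
        , λ { zero _ → k4 8 (λ ()) (λ ()) (λ ()) ∙ (g2 ∙ cong₂ _+_ (h1 0 z≤n (s≤s z≤n)) (h2 1 (<ᵇ⇒< 1 8 _) ∙ reg1 B))
            ; (suc k) k<m → k4 (9 + k) (λ ()) (λ ()) (λ ()) ∙ (g4 (9 + k) (λ ()) (λ ()) (λ ()) ∙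
                              h1 (suc k) z≤n (subst (suc k <_) (sym (+-identityʳ regCount)) k<m)) }
    where
    _∙_ : ∀ {x y z : ℕ} → x ≡ y → y ≡ z → x ≡ z
    _∙_ = trans

  8+≢ : ∀ r x → x < 8 → x ≢ 8 + r
  8+≢ r x lt refl = <-irrefl refl (≤-<-trans (m≤m+n 8 r) lt)

  bookkeeping-frame : ∀ {j f Rσ R'} → Bookkeeping j f Rσ → (∀ x → x < 8 → R' x ≡ Rσ x) → Bookkeeping j f R'
  bookkeeping-frame (bk a0 a1 a2 a3 a4 a5 a6 a7) h =
    bk (kept 0 a0) (kept 1 a1) (kept 2 a2) (kept 3 a3) (kept 4 a4) (kept 5 a5) (kept 6 a6) (kept 7 a7)
    where
    kept : ∀ x {w} {{_ : T (x <ᵇ 8)}} → _ ≡ w → _ ≡ w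
    kept x {{x<8}} e = trans (h x (<ᵇ⇒< x 8 x<8)) e

  mirrors-update : ∀ Rσ R R' r v → Mirrors Rσ R → R' (8 + r) ≡ v → (∀ x → x ≢ 8 + r → R' x ≡ Rσ x) → Mirrors R' (update R r v)
  mirrors-update Rσ R R' r v ag e fr k lt = at (k ≟ r)
    where
    at : Dec (k ≡ r) → R' (8 + k) ≡ update R r v k
    at (yes refl) = trans e (sym (update-same R k v))
    at (no ne) = trans (fr (8 + k) (λ ex → ne (+-cancelˡ-≡ 8 k r ex))) (trans (ag k lt) (sym (update-other R r v k ne)))

  SimStep : ℕ → ℕ → State → State → Set
  SimStep j f σ st' = ∃[ σ' ] (Reach Ψ X σ σ' × SimInv j f st' σ')

  instr-spec : ∀ j f k R i σ → fetch p k ≡ just i → Code Ψ (addr k) (block (addr k) i) → pc σ ≡ suc (addr k) →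
           Bookkeeping j f (regs σ) → Mirrors (regs σ) R → SimStep j f σ (exec (simulatedOracle F X j) i ⟨ k , R ⟩)
  instr-spec j f k R (inc r) σ fe c e B ag with inc-spec (suc (addr k)) (8 + r) σ (code-head (code-tail c)) e
  ... | σ' , rr , pe , h1 , h2 =
    σ' , rr , si (trans pe (sym (addr-suc k (inc r) fe)))
                 (bookkeeping-frame B (λ x lt → h2 x (8+≢ r x lt)))
                 (mirrors-update (regs σ) R (regs σ') r (suc (R r)) ag (trans h1 (cong suc (ag r r<regCount))) h2)
    where
    r<regCount : r < regCount
    r<regCount = s≤s (register≤maxRegister p k (inc r) fe)
  instr-spec j f k R (dec r j') ⟨ .(suc (addr k)) , Rσ ⟩ fe c refl B ag = by-value (R r) refl
    where
    r<regCount : r < regCount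
    r<regCount = s≤s (register≤maxRegister p k (dec r j') fe)
    by-value : ∀ v → R r ≡ v → SimStep j f ⟨ suc (addr k) , Rσ ⟩ (exec (simulatedOracle F X j) (dec r j') ⟨ k , R ⟩)
    by-value zero ev rewrite exec-dec-zero (simulatedOracle F X j) r j' k R ev =
      ⟨ addr j' , Rσ ⟩ , reach-dec-zero (code-head (code-tail c)) (trans (ag r r<regCount) ev) done
      , si refl B ag
    by-value (suc v) ev rewrite exec-dec-suc (simulatedOracle F X j) r j' k R v ev =
      ⟨ suc (suc (addr k)) , update Rσ (8 + r) v ⟩
      , reach-dec-suc (code-head (code-tail c)) (trans (ag r r<regCount) ev) done
      , si (sym (addr-suc k (dec r j') fe))
           (bookkeeping-frame B (λ x lt → update-other Rσ (8 + r) v x (8+≢ r x lt)))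
           (mirrors-update Rσ R (update Rσ (8 + r) v) r v ag (update-same Rσ (8 + r) v) (λ x nx → update-other Rσ (8 + r) v x nx))
  instr-spec j f k R (orc r) σ fe c e B ag = answered (query-spec F b F-bounded (suc (addr k)) r σ (code-tail c) e (reg4 B) (reg5 B) (reg6 B) (reg7 B))
    where
    r<regCount : r < regCount
    r<regCount = s≤s (register≤maxRegister p k (orc r) fe)
    rearrange : ∀ x y → 37 + (x + (7 + suc y)) ≡ 45 + x + y
    rearrange = solve-∀
    answered : Reaches σ (37 + (b + (7 + suc (addr k)))) (QueryAnswered (8 + r) (simulatedOracle F X (regs σ 2) (regs σ (8 + r))) (regs σ)) →
          SimStep j f σ (exec (simulatedOracle F X j) (orc r) ⟨ k , R ⟩)
    answered (σ' , rr , pe , h1 , h4 , h5 , h6 , fr) =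
      σ' , rr , si (trans pe (trans (rearrange b (addr k)) (sym (addr-suc k (orc r) fe))))
                   (bk (trans (fr 0 (λ ()) (λ ()) (λ ()) (λ ())) (reg0 B)) (trans (fr 1 (λ ()) (λ ()) (λ ()) (λ ())) (reg1 B))
                       (trans (fr 2 (λ ()) (λ ()) (λ ()) (λ ())) (reg2 B)) (trans (fr 3 (λ ()) (λ ()) (λ ()) (λ ())) (reg3 B))
                       h4 h5 h6 (trans (fr 7 (λ ()) (λ ()) (λ ()) (λ ())) (reg7 B)))
                   (mirrors-update (regs σ) R (regs σ') r (if simulatedOracle F X j (R r) then 1 else 0) ag
                      (trans h1 (cong₂ (λ u w → if F u ∨ (odd (shiftR u w) ∧ X u) then 1 else 0) (ag r r<regCount) (reg2 B)))
                      (λ x nx → agree-at (regs σ) (regs σ') 4 (trans h4 (sym (reg4 B))) x λ n4 →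
                                agree-at (regs σ) (regs σ') 5 (trans h5 (sym (reg5 B))) x λ n5 →
                                agree-at (regs σ) (regs σ') 6 (trans h6 (sym (reg6 B))) x λ n6 → fr x nx n4 n5 n6))

  reaches-pre : ∀ {σ σ' a P} → Reach Ψ X σ σ' → Reaches σ' a P → Reaches σ a P
  reaches-pre r (s , r' , e , h) = s , reach-trans r r' , e , h

  simout-pre : ∀ {j o σ σ'} → Reach Ψ X σ σ' → SimOut j o σ' → SimOut j o σ
  simout-pre {o = just x} r g = reaches-pre r g
  simout-pre {o = nothing} r g = reaches-pre r g

  simulate : ∀ j f st σ → SimInv j f st σ → SimOut j (run p (simulatedOracle F X j) f st) σ
  simulate j f st σ S with fetch p (pc st) in fe
  ... | nothing =
    reaches-mono (end-spec σ (trans (spc S) (cong (_+ BODY) (offset-past-end p (pc st) (fetch-nothing⇒length≤ p (pc st) fe))))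
                   (reg0 (sbk S)) (reg7 (sbk S)))
                    λ R' h → trans h (sag S 0 (s≤s z≤n))
  simulate j zero ⟨ k , R ⟩ ⟨ .(addr k) , Rσ ⟩ (si refl B ag) | just i =
    reaches-dec-zero (block-head (addr k) i cb) (reg3 B) (timeout-spec j ⟨ 3 , Rσ ⟩ refl B)
    where
    cb : Code Ψ (addr k) (block (addr k) i)
    cb = body-block p BODY k i cBody fe
  simulate j (suc f) ⟨ k , R ⟩ ⟨ .(addr k) , Rσ ⟩ (si refl B ag) | just i =
    continue (instr-spec j f k R i ⟨ suc (addr k) , update Rσ 3 f ⟩ fe cb refl (spend-fuel B)
                         (λ k' lt → trans (update-other Rσ 3 f (8 + k') (λ ())) (ag k' lt)))
    where
    cb : Code Ψ (addr k) (block (addr k) i)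
    cb = body-block p BODY k i cBody fe
    spend-fuel : Bookkeeping j (suc f) Rσ → Bookkeeping j f (update Rσ 3 f)
    spend-fuel (bk a0 a1 a2 a3 a4 a5 a6 a7) =
      bk (trans (update-other Rσ 3 f 0 (λ ())) a0) (trans (update-other Rσ 3 f 1 (λ ())) a1) (trans (update-other Rσ 3 f 2 (λ ())) a2)
         (update-same Rσ 3 f) (trans (update-other Rσ 3 f 4 (λ ())) a4) (trans (update-other Rσ 3 f 5 (λ ())) a5)
         (trans (update-other Rσ 3 f 6 (λ ())) a6) (trans (update-other Rσ 3 f 7 (λ ())) a7)
    continue : SimStep j f ⟨ suc (addr k) , update Rσ 3 f ⟩ (exec (simulatedOracle F X j) i ⟨ k , R ⟩) →
               SimOut j (run p (simulatedOracle F X j) f (exec (simulatedOracle F X j) i ⟨ k , R ⟩)) ⟨ addr k , Rσ ⟩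
    continue (σ2 , r2 , S2) =
      simout-pre {o = run p (simulatedOracle F X j) f (exec (simulatedOracle F X j) i ⟨ k , R ⟩)}
        (reach-dec-suc (block-head (addr k) i cb) (reg3 B) r2)
        (simulate j f (exec (simulatedOracle F X j) i ⟨ k , R ⟩) σ2 S2)

  Finished : (ℕ → ℕ) → Set
  Finished R' = ∃[ j' ] ∃[ st' ] (run p (simulatedOracle F X j') j' (initial n) ≡ just st' × R' 0 ≡ regs st' 0)

  search-spec : ∀ d j σ → pc σ ≡ 5 → Bookkeeping j 0 (regs σ) →
                (∃[ st ] run p (simulatedOracle F X (d + j)) (d + j) (initial n) ≡ just st) → Reaches σ (3 + END) Finished
  search-spec d j σ e B H = reaches-seq (round-start-spec j σ e B) λ σ1 e1 (B1 , ag1) →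
    next-round d H (run p (simulatedOracle F X j) j (initial n)) refl σ1 (simulate j j (initial n) σ1 (si e1 B1 ag1))
    where
    nothing≢just : ∀ {st : State} → nothing ≢ just st
    nothing≢just ()
    next-round : ∀ d → (∃[ st ] run p (simulatedOracle F X (d + j)) (d + j) (initial n) ≡ just st) →
             ∀ o → run p (simulatedOracle F X j) j (initial n) ≡ o → ∀ σ1 → SimOut j o σ1 → Reaches σ1 (3 + END) Finished
    next-round d H (just st') eq σ1 g = reaches-mono g λ R' h → j , st' , eq , h
    next-round zero (st , hh) nothing eq σ1 g = ⊥-elim (nothing≢just (trans (sym eq) hh))
    next-round (suc d') H nothing eq σ1 g = reaches-seq g λ σ2 e2 B2 → search-spec d' (suc j) σ2 e2 B2
      (subst (λ z → ∃[ st ] run p (simulatedOracle F X z) z (initial n) ≡ just st) (sym (+-suc d' j)) H)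

  Ψ-correct : (∃[ j ] ∃[ st ] run p (simulatedOracle F X j) j (initial n) ≡ just st) →
              ∃[ j ] ∃[ st ] (run p (simulatedOracle F X j) j (initial n) ≡ just st × Ψ ⟨ X ⟩ n ↓ output st)
  Ψ-correct (j , st , h) = halted (reaches-seq init-spec λ σ0 e0 B0 → search-spec j 0 σ0 e0 B0
                                     (st , subst (λ z → run p (simulatedOracle F X z) z (initial n) ≡ just st) (sym (+-identityʳ j)) h))
    where
    halted : Reaches (initial n) (3 + END) Finished →
             ∃[ j ] ∃[ st ] (run p (simulatedOracle F X j) j (initial n) ≡ just st × Ψ ⟨ X ⟩ n ↓ output st)
    halted (σ , r , pc≡ , (j' , st' , h' , o)) =
      j' , st' , h' , proj₁ ran , σ , proj₂ ran , output-cong σ st' o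
      where
      ran : ∃[ s ] run Ψ X s (initial n) ≡ just σ
      ran = reach⇒run r (fetch-past-end Ψ (pc σ) (subst (_≤ pc σ) (sym length-Ψ) (≤-reflexive (sym pc≡))))

-- Coding finite sets and programs

shiftR-past : ∀ q j → j ≤ q → shiftR q j ≡ 0
shiftR-past zero j le = n≤0⇒n≡0 le
shiftR-past (suc q) zero le = shiftR-past q 0 z≤n
shiftR-past (suc q) (suc j) (s≤s le) = shiftR-past q ⌊ suc j /2⌋ (≤-trans (≤-pred (⌊n/2⌋<n j)) le)

dbl+ : Bool → ℕ → ℕ
dbl+ bv r = (if bv then 1 else 0) + (r + r)

encode : SetN → ℕ → ℕ
encode τ zero = 0
encode τ (suc L) = dbl+ (τ 0) (encode (λ x → τ (suc x)) L)

odd-double : ∀ r → odd (r + r) ≡ false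
odd-double zero = refl
odd-double (suc r) rewrite +-suc r r = odd-double r

odd-double+1 : ∀ r → odd (suc (r + r)) ≡ true
odd-double+1 zero = refl
odd-double+1 (suc r) rewrite +-suc r r = odd-double+1 r

half-double : ∀ r → ⌊ (r + r) /2⌋ ≡ r
half-double zero = refl
half-double (suc r) rewrite +-suc r r = cong suc (half-double r)

half-double+1 : ∀ r → ⌊ suc (r + r) /2⌋ ≡ r
half-double+1 zero = refl
half-double+1 (suc r) rewrite +-suc r r = cong suc (half-double+1 r)

encode-bit : ∀ L τ x → x < L → odd (shiftR x (encode τ L)) ≡ τ x
encode-bit (suc L) τ zero _ with τ 0
... | true = odd-double+1 (encode (λ x → τ (suc x)) L)
... | false = odd-double (encode (λ x → τ (suc x)) L)
encode-bit (suc L) τ (suc x) (s≤s lt) = trans (cong (λ z → odd (shiftR x z)) half-encode) (encode-bit L (λ y → τ (suc y)) x lt)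
  where
  r : ℕ
  r = encode (λ y → τ (suc y)) L
  half-encode : ⌊ dbl+ (τ 0) r /2⌋ ≡ r
  half-encode with τ 0
  ... | true = half-double+1 r
  ... | false = half-double r

encode-large : ∀ L τ → τ L ≡ true → suc L ≤ encode τ (suc L)
encode-large zero τ e rewrite e = s≤s z≤n
encode-large (suc L) τ e = ≤-trans double-large (m≤n+m (r + r) (if τ 0 then 1 else 0))
  where
  r : ℕ
  r = encode (λ y → τ (suc y)) (suc L)
  ih : suc L ≤ r
  ih = encode-large L (λ y → τ (suc y)) e
  double-large : suc (suc L) ≤ r + r
  double-large = ≤-trans (s≤s (m≤n+m (suc L) L)) (+-mono-≤ ih ih)

-- unpair enumerates ℕ × ℕ diagonal by diagonal.
next-pair : ℕ × ℕ → ℕ × ℕ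
next-pair (a , zero) = (zero , suc a)
next-pair (a , suc b) = (suc a , b)

unpair : ℕ → ℕ × ℕ
unpair zero = (0 , 0)
unpair (suc k) = next-pair (unpair k)

unpair-diagonal : ∀ a b → (∃[ k ] unpair k ≡ (0 , a + b)) → ∃[ k ] unpair k ≡ (a , b)
unpair-diagonal zero b h = h
unpair-diagonal (suc a) b h with unpair-diagonal a (suc b) (subst (λ z → ∃[ k ] unpair k ≡ (0 , z)) (sym (+-suc a b)) h)
... | k , e = suc k , cong next-pair e

unpair-diagonal-start : ∀ s → ∃[ k ] unpair k ≡ (0 , s)
unpair-diagonal-start zero = 0 , refl
unpair-diagonal-start (suc s) with unpair-diagonal s 0 (subst (λ z → ∃[ k ] unpair k ≡ (0 , z)) (sym (+-identityʳ s)) (unpair-diagonal-start s))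
... | k , e = suc k , cong next-pair e

unpair-surjective : ∀ a b → ∃[ k ] unpair k ≡ (a , b)
unpair-surjective a b = unpair-diagonal a b (unpair-diagonal-start (a + b))

decodeInstr′ : ℕ × ℕ → Instr
decodeInstr′ (zero , r) = inc r
decodeInstr′ (suc zero , r) = orc r
decodeInstr′ (suc (suc _) , x) = dec (proj₁ (unpair x)) (proj₂ (unpair x))

decodeInstr : ℕ → Instr
decodeInstr k = decodeInstr′ (unpair k)

decodeInstr-surjective : ∀ i → ∃[ k ] decodeInstr k ≡ i
decodeInstr-surjective (inc r) with unpair-surjective 0 r
... | k , e = k , cong decodeInstr′ e
decodeInstr-surjective (orc r) with unpair-surjective 1 r
... | k , e = k , cong decodeInstr′ e
decodeInstr-surjective (dec r j) with unpair-surjective r j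
... | x , ex with unpair-surjective 2 x
... | k , e = k , trans (cong decodeInstr′ e) (cong (λ z → dec (proj₁ z) (proj₂ z)) ex)

decodeList : ℕ → ℕ → Program
decodeList zero c = []
decodeList (suc l) c = decodeInstr (proj₁ (unpair c)) ∷ decodeList l (proj₂ (unpair c))

decodeList-surjective : ∀ P → ∃[ c ] decodeList (length P) c ≡ P
decodeList-surjective [] = 0 , refl
decodeList-surjective (i ∷ P) with decodeList-surjective P | decodeInstr-surjective i
... | c' , e' | ki , ei with unpair-surjective ki c'
... | c , e = c , cong₂ _∷_ (trans (cong (λ z → decodeInstr (proj₁ z)) e) ei) (trans (cong (λ z → decodeList (length P) (proj₂ z)) e) e')

decodeProgram : ℕ → Program
decodeProgram k = decodeList (proj₁ (unpair k)) (proj₂ (unpair k))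

decodeProgram-surjective : ∀ P → ∃[ k ] decodeProgram k ≡ P
decodeProgram-surjective P with decodeList-surjective P
... | c , e with unpair-surjective (length P) c
... | k , ek = k , trans (cong (λ z → decodeList (proj₁ z) (proj₂ z)) ek) e

-- Forcing

≤⇒≤ᵇ≡true : ∀ {m n} → m ≤ n → (m ≤ᵇ n) ≡ true
≤⇒≤ᵇ≡true {m} {n} le with m ≤ᵇ n | ≤⇒≤ᵇ le
... | true | _ = refl

≤ᵇ≡true⇒≤ : ∀ {m n} → (m ≤ᵇ n) ≡ true → m ≤ n
≤ᵇ≡true⇒≤ {m} {n} e = ≤ᵇ⇒≤ m n (subst T (sym e) tt)

>⇒≤ᵇ≡false : ∀ {m n} → n < m → (m ≤ᵇ n) ≡ false
>⇒≤ᵇ≡false {m} {n} lt with m ≤ᵇ n in e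
... | false = refl
... | true = ⊥-elim (<-irrefl refl (<-≤-trans lt (≤ᵇ≡true⇒≤ e)))

false≢true : false ≢ true
false≢true ()

∧-true : ∀ {a c} → (a ∧ c) ≡ true → a ≡ true × c ≡ true
∧-true {true} {true} _ = refl , refl

∨-true : ∀ {a c} → (a ∨ c) ≡ true → a ≡ true ⊎ c ≡ true
∨-true {true} _ = inj₁ refl
∨-true {false} e = inj₂ e

∨-false : ∀ {a c} → a ≡ false → c ≡ false → (a ∨ c) ≡ false
∨-false refl refl = refl

_∪_ : SetN → SetN → SetN
(X ∪ Y) q = X q ∨ Y q

Finite : SetN → Set
Finite σ = ∃[ M ] (∀ x → M ≤ x → σ x ≡ false)

singleton : ℕ → SetN
singleton x y = y ≡ᵇ x

singleton-bounded : ∀ x y → suc x ≤ y → singleton x y ≡ false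
singleton-bounded x y lt = ≢⇒≡ᵇ-false y x (λ e → <-irrefl (sym e) lt)

singleton⊆ : ∀ {X x} → X x ≡ true → singleton x ⊆ X
singleton⊆ {X} {x} x∈X y e rewrite ≡ᵇ⇒≡ y x (subst T (sym e) tt) = x∈X

module Forcing (A B : SetN) where

  record Condition : Set where
    constructor condition
    field
      F : SetN
      b : ℕ
      C : SetN
      F-bounded : ∀ x → b ≤ x → F x ≡ false
      C-above : ∀ x → C x ≡ true → b ≤ x
      F⊆B : F ⊆ B
      C⊆B : C ⊆ B
      C-infinite : Infinite C
  open Condition public

  record _≼_ (c' c : Condition) : Set where
    field
      b-mono : b c ≤ b c'
      F-agrees : ∀ x → x < b c → F c' x ≡ F c x
      F-new∈C : ∀ x → b c ≤ x → F c' x ≡ true → C c x ≡ true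
      C-shrinks : C c' ⊆ C c
  open _≼_ public

  ≼-refl : ∀ {c} → c ≼ c
  ≼-refl {c} = record { b-mono = ≤-refl ; F-agrees = λ x _ → refl ; C-shrinks = λ x e → e
                       ; F-new∈C = λ x le e → ⊥-elim (false≢true (trans (sym (F-bounded c x le)) e)) }

  ≼-trans : ∀ {c'' c' c} → c'' ≼ c' → c' ≼ c → c'' ≼ c
  ≼-trans {c''} {c'} {c} h g = record
    { b-mono = ≤-trans (b-mono g) (b-mono h)
    ; F-agrees = λ x lt → trans (F-agrees h x (<-≤-trans lt (b-mono g))) (F-agrees g x lt)
    ; F-new∈C = λ x le e → new∈C x le e
    ; C-shrinks = λ x e → C-shrinks g x (C-shrinks h x e) }
    where
    new∈C : ∀ x → b c ≤ x → F c'' x ≡ true → C c x ≡ true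
    new∈C x le e with x <? b c'
    ... | yes lt = F-new∈C g x le (trans (sym (F-agrees h x lt)) e)
    ... | no nlt = C-shrinks g x (F-new∈C h x (≮⇒≥ nlt) e)

  Satisfies : Condition → SetN → Set
  Satisfies c G = (∀ x → x < b c → G x ≡ F c x) × (∀ x → b c ≤ x → G x ≡ true → C c x ≡ true)

  satisfies-mono : ∀ {c' c G} → c' ≼ c → Satisfies c' G → Satisfies c G
  satisfies-mono {c'} {c} {G} h (g1 , g2) = (λ x lt → trans (g1 x (<-≤-trans lt (b-mono h))) (F-agrees h x lt)) , new∈C
    where
    new∈C : ∀ x → b c ≤ x → G x ≡ true → C c x ≡ true
    new∈C x le e with x <? b c'
    ... | yes lt = F-new∈C h x le (trans (sym (g1 x lt)) e)
    ... | no nlt = C-shrinks h x (g2 x (≮⇒≥ nlt) e)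

  extend : ∀ c σ M b' → (∀ x → M ≤ x → σ x ≡ false) → σ ⊆ C c → b c ≤ b' → M ≤ b' →
           Σ Condition λ c' → c' ≼ c × F c' ≡ (F c ∪ σ) × b c' ≡ b'
  extend c σ M b' σ-bounded σ⊆C b≤b' M≤b' =
    condition (F c ∪ σ) b' (λ x → C c x ∧ (b' ≤ᵇ x))
      (λ x le → ∨-false (F-bounded c x (≤-trans b≤b' le)) (σ-bounded x (≤-trans M≤b' le)))
      (λ x e → ≤ᵇ≡true⇒≤ (proj₂ (∧-true e)))
      (λ x e → F∪σ⊆B x (∨-true e))
      (λ x e → C⊆B c x (proj₁ (∧-true e)))
      infinite
    , record { b-mono = b≤b' ; F-agrees = agrees ; F-new∈C = new∈C ; C-shrinks = λ x e → proj₁ (∧-true e) }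
    , refl , refl
    where
    F∪σ⊆B : ∀ x → F c x ≡ true ⊎ σ x ≡ true → B x ≡ true
    F∪σ⊆B x (inj₁ e) = F⊆B c x e
    F∪σ⊆B x (inj₂ e) = C⊆B c x (σ⊆C x e)
    infinite : ∀ k → ∃[ y ] (k ≤ y × (C c y ∧ (b' ≤ᵇ y)) ≡ true)
    infinite k with C-infinite c (k ⊔ b')
    ... | y , le , e = y , ≤-trans (m≤m⊔n k b') le , cong₂ _∧_ e (≤⇒≤ᵇ≡true {b'} {y} (≤-trans (m≤n⊔m k b') le))
    σ-above : ∀ x → x < b c → σ x ≡ false
    σ-above x lt with σ x in e
    ... | false = refl
    ... | true = ⊥-elim (<-irrefl refl (<-≤-trans lt (C-above c x (σ⊆C x e))))
    agrees : ∀ x → x < b c → (F c x ∨ σ x) ≡ F c x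
    agrees x lt rewrite σ-above x lt = ∨-identityʳ (F c x)
    new∈C : ∀ x → b c ≤ x → (F c x ∨ σ x) ≡ true → C c x ≡ true
    new∈C x le e with ∨-true {F c x} e
    ... | inj₁ e1 = ⊥-elim (false≢true (trans (sym (F-bounded c x le)) e1))
    ... | inj₂ e2 = σ⊆C x e2

  Forced : Condition → Program → Set
  Forced c P = ∀ G → Satisfies c G → ¬ Computes P G A

  Meets : Condition → Program → Set
  Meets c P = Σ Condition λ c' → c' ≼ c × Forced c' P

  ConvergesWrongly : Condition → Program → Set
  ConvergesWrongly c P = ∃[ σ ] ∃[ n ] ∃[ s ] ∃[ st ]
    (Finite σ × σ ⊆ C c × run P (F c ∪ σ) s (initial n) ≡ just st × output st ≢ A n)

  DivergesOn : Condition → Program → Set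
  DivergesOn c P = ∃[ n ] ∃[ C' ] (Infinite C' × C' ⊆ C c ×
    (∀ σ → Finite σ → σ ⊆ C' → ∀ s st → run P (F c ∪ σ) s (initial n) ≢ just st))

  -- Moving b past the use of the wrong computation makes every G satisfying the extension
  -- agree with F ∪ σ on that use.
  force-wrong : ∀ c P → ConvergesWrongly c P → Meets c P
  force-wrong c P (σ , n , s , st , (M , σ-bounded) , σ⊆C , halts , wrong) with use-principle P (F c ∪ σ) s (initial n) st halts
  ... | u , hu with extend c σ M (b c ⊔ M ⊔ u) σ-bounded σ⊆C (≤-trans (m≤m⊔n (b c) M) (m≤m⊔n _ u))
                                                          (≤-trans (m≤n⊔m (b c) M) (m≤m⊔n _ u))
  ... | c' , c'≼c , F-c' , b-c' = c' , c'≼c , forced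
    where
    forced : Forced c' P
    forced G (below , _) computes with computes n
    ... | s' , st' , halts' , o =
      wrong (trans (cong output (run-deterministic P G s s' (initial n) st st' (hu G agree) halts')) o)
      where
      agree : AgreeBelow (F c ∪ σ) G u
      agree k lt = sym (trans (below k (subst (k <_) (sym b-c') (<-≤-trans lt (m≤n⊔m _ u)))) (cong (λ f → f k) F-c'))

  -- If P^G(n) converged, it would already converge with the finite part of G between b and
  -- the use, which is a subset of C'.
  force-divergence : ∀ c P → DivergesOn c P → Meets c P
  force-divergence c P (n , C' , C'-infinite , C'⊆C , diverges) = c' , c'≼c , forced
    where
    c' : Condition
    c' = condition (F c) (b c) C' (F-bounded c) (λ x e → C-above c x (C'⊆C x e)) (F⊆B c) (λ x e → C⊆B c x (C'⊆C x e)) C'-infinite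
    c'≼c : c' ≼ c
    c'≼c = record { b-mono = ≤-refl ; F-agrees = λ x _ → refl ; C-shrinks = C'⊆C
                  ; F-new∈C = λ x le e → ⊥-elim (false≢true (trans (sym (F-bounded c x le)) e)) }
    forced : Forced c' P
    forced G (below , above) computes with computes n
    ... | s , st , halts , _ with use-principle P G s (initial n) st halts
    ... | u , hu = diverges σ (u , σ-bounded) σ⊆C' s st (hu (F c ∪ σ) agree)
      where
      σ : SetN
      σ x = G x ∧ (b c ≤ᵇ x) ∧ (suc x ≤ᵇ u)
      σ-bounded : ∀ x → u ≤ x → σ x ≡ false
      σ-bounded x le rewrite >⇒≤ᵇ≡false {suc x} {u} (s≤s le) = trans (cong (G x ∧_) (∧-zeroʳ (b c ≤ᵇ x))) (∧-zeroʳ (G x))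
      σ⊆C' : σ ⊆ C'
      σ⊆C' x e with ∧-true {G x} e
      ... | e1 , e2 = above x (≤ᵇ≡true⇒≤ (proj₁ (∧-true {b c ≤ᵇ x} e2))) e1
      agree : AgreeBelow G (F c ∪ σ) u
      agree k lt with k <? b c
      ... | yes k<b rewrite >⇒≤ᵇ≡false {b c} {k} k<b | ∧-zeroʳ (G k) | ∨-identityʳ (F c k) = below k k<b
      ... | no k≮b rewrite ≤⇒≤ᵇ≡true {b c} {k} (≮⇒≥ k≮b) | ≤⇒≤ᵇ≡true {suc k} {u} lt | F-bounded c k (≮⇒≥ k≮b)
                         | ∧-identityʳ (G k) = refl

  add-element : ∀ c → Σ Condition λ c' → c' ≼ c × b c < b c' × ∃[ x ] (b c ≤ x × x < b c' × F c' x ≡ true)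
  add-element c with C-infinite c (b c)
  ... | x , b≤x , x∈C with extend c (singleton x) (suc x) (suc x) (singleton-bounded x) (singleton⊆ x∈C) (≤-trans b≤x (n≤1+n x)) ≤-refl
  ...   | c' , c'≼c , F-c' , b-c' =
    c' , c'≼c , subst (b c <_) (sym b-c') (s≤s b≤x) , x , b≤x , subst (x <_) (sym b-c') ≤-refl ,
    trans (cong (λ f → f x) F-c') (trans (cong (F c x ∨_) (≡ᵇ-refl x)) (∨-zeroʳ (F c x)))

  -- Given a way to meet every program below every condition, build the descending sequence
  -- that meets the k-th program at stage k and adds a new element after it; its generic G
  -- satisfies all conditions, is an infinite subset of B and computes A by no program.
  module Generic (B-infinite : Infinite B) (meet : ∀ c P → Meets c P) where

    start : Condition
    start = condition (λ _ → false) 0 B (λ _ _ → refl) (λ _ _ → z≤n) (λ x ()) (λ x e → e) B-infinite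

    stage : ℕ → Condition
    met : ℕ → Condition
    stage zero = start
    stage (suc k) = proj₁ (add-element (met k))
    met k = proj₁ (meet (stage k) (decodeProgram k))

    met≼stage : ∀ k → met k ≼ stage k
    met≼stage k = proj₁ (proj₂ (meet (stage k) (decodeProgram k)))

    stage-step : ∀ k → stage (suc k) ≼ stage k
    stage-step k = ≼-trans (proj₁ (proj₂ (add-element (met k)))) (met≼stage k)

    stage-mono : ∀ {k l} → k ≤ l → stage l ≼ stage k
    stage-mono {k} {l} le = subst (λ z → stage z ≼ stage k) (m∸n+n≡m le) (descend (l ∸ k))
      where
      descend : ∀ d → stage (d + k) ≼ stage k
      descend zero = ≼-refl
      descend (suc d) = ≼-trans (stage-step (d + k)) (descend d)

    k≤b-stage : ∀ k → k ≤ b (stage k)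
    k≤b-stage zero = z≤n
    k≤b-stage (suc k) = ≤-trans (s≤s (≤-trans (k≤b-stage k) (b-mono (met≼stage k))))
                               (proj₁ (proj₂ (proj₂ (add-element (met k)))))

    -- x < b (stage (suc x)), so stage x + 1 already decides x.
    G : SetN
    G x = F (stage (suc x)) x

    G-satisfies : ∀ k → Satisfies (stage k) G
    G-satisfies k = below , above
      where
      below : ∀ x → x < b (stage k) → G x ≡ F (stage k) x
      below x lt with k ≤? x
      ... | yes k≤x = F-agrees (stage-mono (≤-trans k≤x (n≤1+n x))) x lt
      ... | no k≰x = sym (F-agrees (stage-mono {suc x} {k} (≰⇒> k≰x)) x (k≤b-stage (suc x)))
      above : ∀ x → b (stage k) ≤ x → G x ≡ true → C (stage k) x ≡ true
      above x le e = F-new∈C (stage-mono {k} {suc x} (≤-trans (≤-trans (k≤b-stage k) le) (n≤1+n x))) x le e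

    G⊆B : G ⊆ B
    G⊆B x e = F⊆B (stage (suc x)) x e

    G-infinite : Infinite G
    G-infinite k with proj₂ (proj₂ (proj₂ (add-element (met k))))
    ... | x , le , lt , x∈F = x , ≤-trans (k≤b-stage k) (≤-trans (b-mono (met≼stage k)) le) ,
                              trans (proj₁ (G-satisfies (suc k)) x lt) x∈F

    ¬≤iT : ¬ A ≤iT B
    ¬≤iT hyp with hyp G G-infinite G⊆B
    ... | P , computes with decodeProgram-surjective P
    ... | k , refl = proj₂ (proj₂ (meet (stage k) (decodeProgram k))) G
                       (satisfies-mono (proj₁ (proj₂ (add-element (met k)))) (G-satisfies (suc k))) computes

Converges : Program → SetN → ℕ → Set
Converges P Y n = ∃[ s ] ∃[ st ] run P Y s (initial n) ≡ just st

module Uniform (lem : ExcludedMiddle 0ℓ) (A B : SetN) where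
  open Forcing A B

  module _ (c : Condition) (P : Program) (S : SetN) (S⊆C : S ⊆ C c) (n : ℕ) where

    RoundHalts : ℕ → State → Set
    RoundHalts j st = run P (simulatedOracle (F c) S j) j (initial n) ≡ just st

    -- The oracle of round j is F ∪ σ for the finite set σ = {q ∈ S | bit q of j is set} ⊆ C.
    round-sound : ¬ ConvergesWrongly c P → ∀ j st → RoundHalts j st → output st ≡ A n
    round-sound ¬wrong j st h with output st Data.Bool.≟ A n
    ... | yes e = e
    ... | no ne = ⊥-elim (¬wrong (σ , n , j , st , (j , σ-finite) , σ⊆C , h , ne))
      where
      σ : SetN
      σ q = odd (shiftR q j) ∧ S q
      σ-finite : ∀ x → j ≤ x → σ x ≡ false
      σ-finite x le rewrite shiftR-past x j le = refl
      σ⊆C : σ ⊆ C c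
      σ⊆C q e = S⊆C q (proj₂ (∧-true {odd (shiftR q j)} e))

    -- Code σ, up to the use u of the computation, by a j whose top bit N also makes j exceed the
    -- time s the computation needs.
    round-complete : ∀ σ → Finite σ → σ ⊆ S → Converges P (F c ∪ σ) n → ∃[ j ] ∃[ st ] RoundHalts j st
    round-complete σ (M , σM) σ⊆S (s , st , r) with use-principle P (F c ∪ σ) s (initial n) st r
    ... | u , hu = j , st , subst (λ z → run P (simulatedOracle (F c) S j) z (initial n) ≡ just st) (m+[n∸m]≡n s≤j)
                     (run-more-fuel P (simulatedOracle (F c) S j) s (initial n) st (hu (simulatedOracle (F c) S j) agree) (j ∸ s))
      where
      N : ℕ
      N = M ⊔ u ⊔ s
      τ : SetN
      τ x = σ x ∨ (x ≡ᵇ N)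
      j : ℕ
      j = encode τ (suc N)
      bit-σ : ∀ x → x < N → odd (shiftR x j) ≡ σ x
      bit-σ x lt = trans (encode-bit (suc N) τ x (≤-trans lt (n≤1+n N)))
                         (trans (cong (σ x ∨_) (≢⇒≡ᵇ-false x N (λ e → <-irrefl e lt))) (∨-identityʳ (σ x)))
      σ∧S : ∀ k → σ k ≡ (σ k ∧ S k)
      σ∧S k with σ k in e
      ... | false = refl
      ... | true = sym (σ⊆S k e)
      agree : AgreeBelow (F c ∪ σ) (simulatedOracle (F c) S j) u
      agree k lt rewrite bit-σ k (<-≤-trans lt (≤-trans (m≤n⊔m M u) (m≤m⊔n (M ⊔ u) s))) = cong (F c k ∨_) (σ∧S k)
      s≤j : s ≤ j
      s≤j = ≤-trans (m≤n⊔m (M ⊔ u) s) (≤-trans (n≤1+n N) (encode-large N τ (trans (cong (σ N ∨_) (≡ᵇ-refl N)) (∨-zeroʳ (σ N)))))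

  uniform-on-C : ∀ c P → ¬ ConvergesWrongly c P → ¬ DivergesOn c P → A ≤uiT C c
  uniform-on-C c P ¬wrong ¬diverges = Ψ , computes
    where
    Ψ : Program
    Ψ = Compiler.Ψ P (F c) (b c)
    computes : ∀ S → Infinite S → S ⊆ C c → Computes Ψ S A
    computes S S-infinite S⊆C n = by-cases (lem {∃[ σ ] (Finite σ × σ ⊆ S × Converges P (F c ∪ σ) n)})
      where
      answer : ∃[ j ] ∃[ st ] (RoundHalts c P S S⊆C n j st × Ψ ⟨ S ⟩ n ↓ output st) → Ψ ⟨ S ⟩ n ↓ A n
      answer (j , st , h , s , σ , hs , o) = s , σ , hs , trans o (round-sound c P S S⊆C n ¬wrong j st h)
      by-cases : Dec (∃[ σ ] (Finite σ × σ ⊆ S × Converges P (F c ∪ σ) n)) → Ψ ⟨ S ⟩ n ↓ A n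
      by-cases (yes (σ , fin , sub , conv)) =
        answer (Simulation.Ψ-correct P (F c) (b c) (F-bounded c) S n (round-complete c P S S⊆C n σ fin sub conv))
      by-cases (no ¬converges) =
        ⊥-elim (¬diverges (n , S , S-infinite , S⊆C , λ σ fin sub s st eq → ¬converges (σ , fin , sub , s , st , eq)))

  force-or-uniform : ∀ c P → Meets c P ⊎ A ≤uiT C c
  force-or-uniform c P with lem {ConvergesWrongly c P}
  ... | yes wrong = inj₁ (force-wrong c P wrong)
  ... | no ¬wrong with lem {DivergesOn c P}
  ...   | yes diverges = inj₁ (force-divergence c P diverges)
  ...   | no ¬diverges = inj₂ (uniform-on-C c P ¬wrong ¬diverges)

theorem1p2 : ExcludedMiddle 0ℓ → (A B : SetN) → Infinite B → A ≤iT B →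
    ∃[ C ] (Infinite C × C ⊆ B × A ≤uiT C)
theorem1p2 lem A B B-infinite hyp with lem {∃[ C ] (Infinite C × C ⊆ B × A ≤uiT C)}
... | yes goal = goal
... | no ¬goal = ⊥-elim (Generic.¬≤iT B-infinite meet hyp)
  where
  open Forcing A B
  meet : ∀ c P → Meets c P
  meet c P with Uniform.force-or-uniform lem A B c P
  ... | inj₁ met = met
  ... | inj₂ uniform = ⊥-elim (¬goal (C c , C-infinite c , C⊆B c , uniform))
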